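{- Let $A\subseteq \mathrm{Aff}(\mathbb{F}_q)$ be a set and let $\Gamma \subseteq \mathrm{Aff} (\mathbb{F}_q)$ be a subgroup such that for any non-trivial multiplicative character $\chi$ of $\mathbb{F}_q^*$ there is $\gamma = (a,b) \in \Gamma$ with $\chi(a) \neq 1$. Let $z\in \mathrm{Aff} (\mathbb{F}_q)$ be arbitrary, $n\ge 1$ a positive integer, and suppose $|A|^n |\Gamma|^2 > q^{n+2} (q-1)^2$. Then $A^n \cap z\Gamma \neq \emptyset$ and $A^n \cap \Gamma z \neq \emptyset$.
   Context: $\mathrm{Aff}(\mathbb{F}_q)$ is the affine group of maps $x\mapsto ax+b$, $a\in\mathbb{F}_q^*$, $b\in\mathbb{F}_q$, written $(a,b)$ (equivalently the matrices $\begin{pmatrix} a& b\\ 0&1\end{pmatrix}$ under multiplication). $A^n$ is the set of products of $n$ elements of $A$. -}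

module Defs where

open import Level using (0ℓ)
open import Data.Nat using (ℕ; suc; _∸_) renaming (_*_ to _*ℕ_; _^_ to _^ℕ_; _<_ to _<ℕ_)
open import Data.Integer using (ℤ; +_) renaming (_+_ to _+ℤ_; _-_ to _-ℤ_)
open import Data.Integer.Divisibility using () renaming (_∣_ to _∣ℤ_)
open import Data.Product using (Σ; ∃; _×_; _,_; proj₁; proj₂)
open import Data.List using (List; length; foldr; []; _∷_)
open import Data.List.Membership.Propositional using (_∈_)
open import Data.List.Relation.Unary.Unique.Propositional using (Unique)
open import Data.Vec using (Vec; toList)
open import Data.Vec.Relation.Unary.All using (All)
open import Relation.Binary.PropositionalEquality using (_≡_; _≢_)
open import Relation.Nullary using (¬_; Dec)
open import Algebra.Structures using (IsCommutativeRing)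

record FiniteField : Set₁ where
  field
    Carrier : Set
    _+_ _*_ : Carrier → Carrier → Carrier
    -_      : Carrier → Carrier
    0# 1#   : Carrier
    isCommutativeRing : IsCommutativeRing _≡_ _+_ _*_ -_ 0# 1#
    0≢1     : 0# ≢ 1#
    inverse : ∀ x → x ≢ 0# → ∃ λ y → x * y ≡ 1#
    _≟_     : (x y : Carrier) → Dec (x ≡ y)
    elements : List Carrier
    elements-unique   : Unique elements
    elements-complete : ∀ x → x ∈ elements

  order : ℕ
  order = length elements

module Affine (F : FiniteField) where
  open FiniteField F

  -- (a , b) stands for the map x ↦ a x + b, i.e. the matrix (a b ; 0 1).
  -- Elements of Aff(F_q) are pairs with a ≠ 0 (see IsAff).
  Aff : Set
  Aff = Carrier × Carrier

  IsAff : Aff → Set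
  IsAff (a , b) = a ≢ 0#

  _∘ₐ_ : Aff → Aff → Aff
  (a , b) ∘ₐ (c , d) = (a * c , (a * d) + b)

  idₐ : Aff
  idₐ = (1# , 0#)

  prodₐ : List Aff → Aff
  prodₐ = foldr _∘ₐ_ idₐ

  record AffSubset : Set where
    field
      elems  : List Aff
      unique : Unique elems
      valid  : ∀ {g} → g ∈ elems → IsAff g
    size : ℕ
    size = length elems

  record IsSubgroup (Γ : AffSubset) : Set where
    open AffSubset Γ
    field
      has-id  : idₐ ∈ elems
      closed  : ∀ {g h} → g ∈ elems → h ∈ elems → (g ∘ₐ h) ∈ elems
      has-inv : ∀ {g} → g ∈ elems → ∃ λ h → h ∈ elems × (g ∘ₐ h) ≡ idₐ

  -- Every character F_q^* → ℂ^* takes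
  -- values in the (q-1)-th roots of unity μ_{q-1} ≅ ℤ/(q-1)ℤ, so a character
  -- is encoded as its discrete logarithm: χ : F → ℤ (values on 0 irrelevant)
  -- with χ(xy) ≡ χ(x) + χ(y) mod (q-1) on nonzero x, y.
  -- "χ(x) = 1" corresponds to "(q-1) ∣ χ(x)".
  record MultCharacter : Set where
    field
      χ   : Carrier → ℤ
      hom : ∀ x y → x ≢ 0# → y ≢ 0# →
            (+ (order ∸ 1)) ∣ℤ (χ (x * y) -ℤ (χ x +ℤ χ y))

  IsTrivialValue : MultCharacter → Carrier → Set
  IsTrivialValue c x = (+ (order ∸ 1)) ∣ℤ MultCharacter.χ c x

  NonTrivial : MultCharacter → Set
  NonTrivial c = ∃ λ x → x ≢ 0# × ¬ IsTrivialValue c x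

  MeetsLeftCoset : (n : ℕ) → AffSubset → Aff → AffSubset → Set
  MeetsLeftCoset n A z Γ =
    Σ (Vec Aff n) λ v → All (_∈ AffSubset.elems A) v ×
      ∃ λ γ → γ ∈ AffSubset.elems Γ × prodₐ (toList v) ≡ (z ∘ₐ γ)

  MeetsRightCoset : (n : ℕ) → AffSubset → Aff → AffSubset → Set
  MeetsRightCoset n A z Γ =
    Σ (Vec Aff n) λ v → All (_∈ AffSubset.elems A) v ×
      ∃ λ γ → γ ∈ AffSubset.elems Γ × prodₐ (toList v) ≡ (γ ∘ₐ z)

  CharNonTrivialOn : MultCharacter → Aff → Set
  CharNonTrivialOn c (a , b) = ¬ IsTrivialValue c a

{-# OPTIONS --safe #-}
module Submission where

-- The character hypothesis forces the linear parts of Γ to be all of F_q^*: otherwise some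
-- character would be trivial on them but not on a missing unit.  Conjugation scales
-- translations, so either Γ contains every translation and is all of Aff(F_q), or Γ meets
-- the translations trivially; then Γ is abelian, fixes a point p and is exactly the
-- stabiliser of p, so |Γ| ≤ q - 1.  In the first case every product of n elements of A lies
-- in zΓ and in Γz.  In the second the hypothesis gives |A|^n > q^(n+2), and the averaging
-- operator T f(x) = Σ_{g∈A} f(g x) satisfies ‖T f‖² ≤ q |A| ‖f‖² on mean-zero f
-- (Cauchy–Schwarz over A, then an exact computation over the whole group).  Applied n times
-- to f = q δ_r - 1 this shows that A^n maps any point to any point; a word w with
-- w p = z p (resp. w (z⁻¹ p) = p) then has z⁻¹ w (resp. w z⁻¹) in the stabiliser Γ.

open import Algebra.Bundles using (CommutativeRing; CommutativeSemigroup)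
open import Algebra.Core using (Op₂)
import Algebra.Properties.Semiring.Exp as Exp
open import Algebra.Solver.Ring.AlmostCommutativeRing using (fromCommutativeRing; _-Raw-AlmostCommutative⟶_)
open import Algebra.Structures using (IsCommutativeMonoid)
open import Data.Empty using (⊥-elim)
open import Data.Integer as ℤ using (ℤ; +_; 0ℤ; 1ℤ; +≤+)
import Data.Integer.Properties as ℤP
open import Data.List using (List; []; _∷_; _++_; map; length; filter; cartesianProduct)
open import Data.List.Membership.Propositional using (_∈_; _∉_)
import Data.List.Membership.Propositional.Properties as ∈
open import Data.List.Membership.Propositional.Properties.WithK using (unique∧set⇒bag)
open import Data.List.Relation.Binary.BagAndSetEquality using (∼bag⇒↭)
open import Data.List.Relation.Binary.Permutation.Propositional using (_↭_)
import Data.List.Relation.Binary.Permutation.Propositional.Properties as ↭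
open import Data.List.Relation.Unary.All.Properties using (¬Any⇒All¬)
open import Data.List.Relation.Unary.AllPairs using (_∷_)
open import Data.List.Relation.Unary.Any using (here; there)
open import Data.List.Relation.Unary.Unique.Propositional using (Unique)
import Data.List.Relation.Unary.Unique.Propositional.Properties as Unique
open import Data.Maybe using (Maybe; just; nothing)
open import Data.Nat as ℕ using (ℕ; zero; suc)
open import Data.Nat.DivMod using (_%_; _/_; m≡m%n+[m/n]*n; m%n<n)
open import Data.Nat.Induction using (<-rec)
import Data.Nat.Properties as ℕP
open import Data.Product using (∃; ∃-syntax; _×_; _,_; proj₁; proj₂)
import Data.Product.Properties as ×
open import Data.Sign as Sign using (Sign)
open import Data.Sum using (_⊎_; inj₁; inj₂)
open import Data.Vec as Vec using (Vec; toList)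
import Data.Vec.Relation.Unary.All as VAll
open import Function.Base using (_∘_)
open import Function.Bundles using (mk⇔)
open import Level using (0ℓ)
open import Relation.Binary.Bundles using (Setoid)
open import Relation.Binary.Definitions using (DecidableEquality)
open import Relation.Binary.PropositionalEquality as ≡ using (_≡_; _≢_; cong; cong₂; sym; subst; subst₂; module ≡-Reasoning)
import Relation.Binary.Reasoning.Setoid
open import Relation.Nullary using (¬_; yes; no; ¬?; _×-dec_)
open import Relation.Nullary.Decidable using (decidable-stable)
open import Relation.Unary using (Decidable)

open import Defs

least-witness : ∀ {P : ℕ → Set} → Decidable P → ∀ {n} → P n → ∃[ m ] P m × (∀ {k} → k ℕ.< m → ¬ P k)
least-witness {P} P? {n} = <-rec (λ n → P n → Least) step n
  where
  Least : Set
  Least = ∃[ m ] P m × (∀ {k} → k ℕ.< m → ¬ P k)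
  step : ∀ n → (∀ {k} → k ℕ.< n → P k → Least) → P n → Least
  step n smaller Pn with ℕP.anyUpTo? P? n
  ... | yes (k , k<n , Pk) = smaller k<n Pk
  ... | no  none           = n , Pn , λ k<n Pk → none (_ , k<n , Pk)

All-replicate : ∀ {A : Set} {P : A → Set} {a} n → P a → VAll.All P (Vec.replicate n a)
All-replicate zero    _  = VAll.[]
All-replicate (suc n) Pa = Pa VAll.∷ All-replicate n Pa

<-length^⇒nonempty : ∀ {A : Set} (l : List A) {n x y} → 1 ℕ.≤ n → x ℕ.< length l ℕ.^ n ℕ.* y → ∃[ a ] a ∈ l
<-length^⇒nonempty []      {suc _} _ ()
<-length^⇒nonempty (a ∷ _) _ _ = a , here ≡.refl

x*c<y*d⇒x<y : ∀ x y {c d} → d ℕ.≤ c → x ℕ.* c ℕ.< y ℕ.* d → x ℕ.< y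
x*c<y*d⇒x<y x y {c} {d} d≤c xc<yd = ℕP.*-cancelʳ-< c x y (ℕP.<-≤-trans xc<yd (ℕP.*-monoʳ-≤ y d≤c))

-- The ring solver with integer coefficients.  With the ring's own elements as coefficients,
-- as in Algebra.Solver.Ring.Simple, 1 - 1 does not normalise to 0 in an abstract ring.
module IntegerCoefficientSolver (R : CommutativeRing 0ℓ 0ℓ) where

  open CommutativeRing R renaming (sym to ≈-sym)
  open import Relation.Binary.Reasoning.Setoid setoid
  open import Algebra.Properties.Ring ring using (-‿involutive; -0#≈0#; -‿anti-homo-+; -‿distribˡ-*)
  open import Algebra.Properties.Semiring.Mult semiring using (×1-homo-*) renaming (_×_ to _×ₙ_)
  open import Algebra.Properties.Monoid.Mult +-monoid using (×-homo-+)
  open import Algebra.Properties.CommutativeSemigroup *-commutativeSemigroup using (interchange)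

  ⟦_⟧ℕ : ℕ → Carrier
  ⟦ n ⟧ℕ = n ×ₙ 1#

  ⟦_⟧ : ℤ → Carrier
  ⟦ + n ⟧        = ⟦ n ⟧ℕ
  ⟦ ℤ.-[1+ n ] ⟧ = - ⟦ suc n ⟧ℕ

  ⟦_⟧ₛ : Sign → Carrier
  ⟦ Sign.+ ⟧ₛ = 1#
  ⟦ Sign.- ⟧ₛ = - 1#

  ⟦◃⟧ : ∀ s n → ⟦ s ℤ.◃ n ⟧ ≈ ⟦ s ⟧ₛ * ⟦ n ⟧ℕ
  ⟦◃⟧ s      zero    = ≈-sym (zeroʳ ⟦ s ⟧ₛ)
  ⟦◃⟧ Sign.+ (suc n) = ≈-sym (*-identityˡ _)
  ⟦◃⟧ Sign.- (suc n) = trans (-‿cong (≈-sym (*-identityˡ _))) (-‿distribˡ-* 1# _)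

  ⟦⟧ₛ-homo-* : ∀ s t → ⟦ s Sign.* t ⟧ₛ ≈ ⟦ s ⟧ₛ * ⟦ t ⟧ₛ
  ⟦⟧ₛ-homo-* Sign.+ Sign.+ = ≈-sym (*-identityˡ 1#)
  ⟦⟧ₛ-homo-* Sign.+ Sign.- = ≈-sym (*-identityˡ _)
  ⟦⟧ₛ-homo-* Sign.- Sign.+ = ≈-sym (*-identityʳ _)
  ⟦⟧ₛ-homo-* Sign.- Sign.- = begin
    1#              ≈⟨ -‿involutive 1# ⟨
    - (- 1#)        ≈⟨ -‿cong (*-identityˡ _) ⟨
    - (1# * (- 1#)) ≈⟨ -‿distribˡ-* 1# (- 1#) ⟩
    (- 1#) * (- 1#) ∎

  ⟦⟧-sign-abs : ∀ i → ⟦ i ⟧ ≈ ⟦ ℤ.sign i ⟧ₛ * ⟦ ℤ.∣ i ∣ ⟧ℕ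
  ⟦⟧-sign-abs i = trans (reflexive (cong ⟦_⟧ (≡.sym (ℤP.◃-inverse i)))) (⟦◃⟧ (ℤ.sign i) ℤ.∣ i ∣)

  ⟦⟧-homo-* : ∀ i j → ⟦ i ℤ.* j ⟧ ≈ ⟦ i ⟧ * ⟦ j ⟧
  ⟦⟧-homo-* i j = begin
    ⟦ ℤ.sign i Sign.* ℤ.sign j ℤ.◃ ℤ.∣ i ∣ ℕ.* ℤ.∣ j ∣ ⟧
      ≈⟨ ⟦◃⟧ (ℤ.sign i Sign.* ℤ.sign j) (ℤ.∣ i ∣ ℕ.* ℤ.∣ j ∣) ⟩
    ⟦ ℤ.sign i Sign.* ℤ.sign j ⟧ₛ * ⟦ ℤ.∣ i ∣ ℕ.* ℤ.∣ j ∣ ⟧ℕ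
      ≈⟨ *-cong (⟦⟧ₛ-homo-* (ℤ.sign i) (ℤ.sign j)) (×1-homo-* ℤ.∣ i ∣ ℤ.∣ j ∣) ⟩
    (⟦ ℤ.sign i ⟧ₛ * ⟦ ℤ.sign j ⟧ₛ) * (⟦ ℤ.∣ i ∣ ⟧ℕ * ⟦ ℤ.∣ j ∣ ⟧ℕ)
      ≈⟨ interchange _ _ _ _ ⟩
    (⟦ ℤ.sign i ⟧ₛ * ⟦ ℤ.∣ i ∣ ⟧ℕ) * (⟦ ℤ.sign j ⟧ₛ * ⟦ ℤ.∣ j ∣ ⟧ℕ)
      ≈⟨ *-cong (⟦⟧-sign-abs i) (⟦⟧-sign-abs j) ⟨
    ⟦ i ⟧ * ⟦ j ⟧                                                ∎

  ⟦⟧-homo-neg : ∀ i → ⟦ ℤ.- i ⟧ ≈ - ⟦ i ⟧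
  ⟦⟧-homo-neg (+ zero)   = ≈-sym -0#≈0#
  ⟦⟧-homo-neg ℤ.+[1+ n ] = refl
  ⟦⟧-homo-neg ℤ.-[1+ n ] = ≈-sym (-‿involutive _)

  ⟦⟧ℕ-homo-∸ : ∀ m n → n ℕ.≤ m → ⟦ m ℕ.∸ n ⟧ℕ ≈ ⟦ m ⟧ℕ - ⟦ n ⟧ℕ
  ⟦⟧ℕ-homo-∸ m n n≤m = begin
    ⟦ m ℕ.∸ n ⟧ℕ                     ≈⟨ +-identityʳ _ ⟨
    ⟦ m ℕ.∸ n ⟧ℕ + 0#                ≈⟨ +-congˡ (-‿inverseʳ ⟦ n ⟧ℕ) ⟨
    ⟦ m ℕ.∸ n ⟧ℕ + (⟦ n ⟧ℕ - ⟦ n ⟧ℕ) ≈⟨ +-assoc _ _ _ ⟨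
    (⟦ m ℕ.∸ n ⟧ℕ + ⟦ n ⟧ℕ) - ⟦ n ⟧ℕ ≈⟨ +-congʳ (×-homo-+ 1# (m ℕ.∸ n) n) ⟨
    ⟦ m ℕ.∸ n ℕ.+ n ⟧ℕ - ⟦ n ⟧ℕ      ≡⟨ cong (λ k → ⟦ k ⟧ℕ - ⟦ n ⟧ℕ) (ℕP.m∸n+n≡m n≤m) ⟩
    ⟦ m ⟧ℕ - ⟦ n ⟧ℕ                  ∎

  ⟦⟧-homo-⊖ : ∀ m n → ⟦ m ℤ.⊖ n ⟧ ≈ ⟦ m ⟧ℕ - ⟦ n ⟧ℕ
  ⟦⟧-homo-⊖ m n with ℕP.≤-total n m
  ... | inj₁ n≤m = trans (reflexive (cong ⟦_⟧ (ℤP.⊖-≥ n≤m))) (⟦⟧ℕ-homo-∸ m n n≤m)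
  ... | inj₂ m≤n = begin
    ⟦ m ℤ.⊖ n ⟧           ≡⟨ cong ⟦_⟧ (ℤP.⊖-swap m n) ⟩
    ⟦ ℤ.- (n ℤ.⊖ m) ⟧     ≈⟨ ⟦⟧-homo-neg (n ℤ.⊖ m) ⟩
    - ⟦ n ℤ.⊖ m ⟧         ≡⟨ cong (-_ ∘ ⟦_⟧) (ℤP.⊖-≥ m≤n) ⟩
    - ⟦ n ℕ.∸ m ⟧ℕ        ≈⟨ -‿cong (⟦⟧ℕ-homo-∸ n m m≤n) ⟩
    - (⟦ n ⟧ℕ - ⟦ m ⟧ℕ)   ≈⟨ -‿anti-homo-+ _ _ ⟩
    - (- ⟦ m ⟧ℕ) - ⟦ n ⟧ℕ ≈⟨ +-congʳ (-‿involutive _) ⟩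
    ⟦ m ⟧ℕ - ⟦ n ⟧ℕ       ∎

  ⟦⟧-homo-+ : ∀ i j → ⟦ i ℤ.+ j ⟧ ≈ ⟦ i ⟧ + ⟦ j ⟧
  ⟦⟧-homo-+ (+ m)      (+ n)      = ×-homo-+ 1# m n
  ⟦⟧-homo-+ (+ m)      ℤ.-[1+ n ] = ⟦⟧-homo-⊖ m (suc n)
  ⟦⟧-homo-+ ℤ.-[1+ m ] (+ n)      = trans (⟦⟧-homo-⊖ n (suc m)) (+-comm _ _)
  ⟦⟧-homo-+ ℤ.-[1+ m ] ℤ.-[1+ n ] = begin
    - ⟦ suc (suc (m ℕ.+ n)) ⟧ℕ  ≡⟨ cong (λ k → - ⟦ k ⟧ℕ) (ℕP.+-suc (suc m) n) ⟨
    - ⟦ suc m ℕ.+ suc n ⟧ℕ      ≈⟨ -‿cong (×-homo-+ 1# (suc m) (suc n)) ⟩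
    - (⟦ suc m ⟧ℕ + ⟦ suc n ⟧ℕ) ≈⟨ -‿anti-homo-+ _ _ ⟩
    - ⟦ suc n ⟧ℕ + - ⟦ suc m ⟧ℕ ≈⟨ +-comm _ _ ⟩
    - ⟦ suc m ⟧ℕ + - ⟦ suc n ⟧ℕ ∎

  homomorphism : ℤ.+-*-rawRing -Raw-AlmostCommutative⟶ fromCommutativeRing R
  homomorphism = record
    { ⟦_⟧ = ⟦_⟧ ; +-homo = ⟦⟧-homo-+ ; *-homo = ⟦⟧-homo-* ; -‿homo = ⟦⟧-homo-neg
    ; 0-homo = refl ; 1-homo = +-identityʳ 1# }

  coefficient≟ : ∀ i j → Maybe (⟦ i ⟧ ≈ ⟦ j ⟧)
  coefficient≟ i j with i ℤ.≟ j
  ... | yes ≡.refl = just refl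
  ... | no  _      = nothing

  open import Algebra.Solver.Ring ℤ.+-*-rawRing (fromCommutativeRing R) homomorphism coefficient≟ public
    using (solve; _:=_; _:+_; _:*_; _:-_; :-_; con)

module Removal {A : Set} (_≟_ : DecidableEquality A) where

  remove : A → List A → List A
  remove x = filter (λ y → ¬? (y ≟ x))

  ∈-remove⁺ : ∀ {x z} {l : List A} → z ∈ l → z ≢ x → z ∈ remove x l
  ∈-remove⁺ = ∈.∈-filter⁺ (λ y → ¬? (y ≟ _))

  ∈-remove⁻ : ∀ {x z} (l : List A) → z ∈ remove x l → z ∈ l × z ≢ x
  ∈-remove⁻ l = ∈.∈-filter⁻ (λ y → ¬? (y ≟ _)) {xs = l}

  remove-unique : ∀ {x} {l : List A} → Unique l → Unique (remove x l)
  remove-unique = Unique.filter⁺ (λ y → ¬? (y ≟ _))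

  ↭-remove : ∀ {x} {l : List A} → Unique l → x ∈ l → l ↭ x ∷ remove x l
  ↭-remove {x} {l} l! x∈l = ∼bag⇒↭ (unique∧set⇒bag l! x∷rest! (mk⇔ to from))
    where
    x∷rest! : Unique (x ∷ remove x l)
    x∷rest! = ¬Any⇒All¬ _ (λ x∈rest → proj₂ (∈-remove⁻ l x∈rest) ≡.refl) ∷ remove-unique l!
    to : ∀ {z} → z ∈ l → z ∈ x ∷ remove x l
    to {z} z∈l with z ≟ x
    ... | yes z≡x = here z≡x
    ... | no  z≢x = there (∈-remove⁺ z∈l z≢x)
    from : ∀ {z} → z ∈ x ∷ remove x l → z ∈ l
    from (here ≡.refl) = x∈l
    from (there z∈rest) = proj₁ (∈-remove⁻ l z∈rest)

module Fold {B : Set} {_⊕_ : Op₂ B} {ε : B} (isCommutativeMonoid : IsCommutativeMonoid _≡_ _⊕_ ε) where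
  open IsCommutativeMonoid isCommutativeMonoid using (assoc; comm; identityˡ; isCommutativeSemigroup)

  private
    commutativeSemigroup : CommutativeSemigroup 0ℓ 0ℓ
    commutativeSemigroup = record { isCommutativeSemigroup = isCommutativeSemigroup }

  open import Algebra.Properties.CommutativeSemigroup commutativeSemigroup using (interchange)
  open _↭_

  private variable A C : Set

  fold : List A → (A → B) → B
  fold []      f = ε
  fold (x ∷ l) f = f x ⊕ fold l f

  fold-cong : ∀ (l : List A) {f g : A → B} → (∀ {x} → x ∈ l → f x ≡ g x) → fold l f ≡ fold l g
  fold-cong []      f≗g = ≡.refl
  fold-cong (x ∷ l) f≗g = cong₂ _⊕_ (f≗g (here ≡.refl)) (fold-cong l (f≗g ∘ there))

  fold-++ : ∀ (l m : List A) (f : A → B) → fold (l ++ m) f ≡ fold l f ⊕ fold m f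
  fold-++ []      m f = sym (identityˡ _)
  fold-++ (x ∷ l) m f = ≡.trans (cong (f x ⊕_) (fold-++ l m f)) (sym (assoc _ _ _))

  fold-map : ∀ (g : A → C) (l : List A) (f : C → B) → fold (map g l) f ≡ fold l (f ∘ g)
  fold-map g []      f = ≡.refl
  fold-map g (x ∷ l) f = cong (f (g x) ⊕_) (fold-map g l f)

  fold-distrib : ∀ (l : List A) (f g : A → B) → fold l (λ x → f x ⊕ g x) ≡ fold l f ⊕ fold l g
  fold-distrib []      f g = sym (identityˡ ε)
  fold-distrib (x ∷ l) f g =
    ≡.trans (cong ((f x ⊕ g x) ⊕_) (fold-distrib l f g)) (interchange (f x) (g x) (fold l f) (fold l g))

  fold-ε : ∀ (l : List A) → fold l (λ _ → ε) ≡ ε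
  fold-ε []      = ≡.refl
  fold-ε (_ ∷ l) = ≡.trans (identityˡ _) (fold-ε l)

  fold-comm : ∀ (l : List A) (m : List C) (f : A → C → B) →
              fold l (λ x → fold m (f x)) ≡ fold m (λ y → fold l (λ x → f x y))
  fold-comm []      m f = sym (fold-ε m)
  fold-comm (x ∷ l) m f =
    ≡.trans (cong (fold m (f x) ⊕_) (fold-comm l m f)) (sym (fold-distrib m (f x) _))

  fold-↭ : ∀ {l m : List A} (f : A → B) → l ↭ m → fold l f ≡ fold m f
  fold-↭ f refl           = ≡.refl
  fold-↭ f (prep x p)     = cong (f x ⊕_) (fold-↭ f p)
  fold-↭ f (swap x y p)  = begin
    f x ⊕ (f y ⊕ _)   ≡⟨ sym (assoc _ _ _) ⟩
    (f x ⊕ f y) ⊕ _   ≡⟨ cong₂ _⊕_ (comm _ _) (fold-↭ f p) ⟩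
    (f y ⊕ f x) ⊕ _   ≡⟨ assoc _ _ _ ⟩
    f y ⊕ (f x ⊕ _)   ∎
    where open ≡-Reasoning
  fold-↭ f (trans p q)    = ≡.trans (fold-↭ f p) (fold-↭ f q)

  fold-sameMembers : ∀ {l m : List A} (f : A → B) → Unique l → Unique m →
                     (∀ {x} → x ∈ l → x ∈ m) → (∀ {x} → x ∈ m → x ∈ l) → fold l f ≡ fold m f
  fold-sameMembers f l! m! l⊆m m⊆l =
    fold-↭ f (∼bag⇒↭ (unique∧set⇒bag l! m! (mk⇔ l⊆m m⊆l)))

  fold-bijection : ∀ {l : List A} (σ τ : A → A) → Unique l →
                   (∀ {x} → x ∈ l → σ x ∈ l) → (∀ {x} → x ∈ l → τ x ∈ l) →
                   (∀ x → τ (σ x) ≡ x) → (∀ x → σ (τ x) ≡ x) →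
                   (f : A → B) → fold l (f ∘ σ) ≡ fold l f
  fold-bijection {l = l} σ τ l! σ-closed τ-closed τσ στ f = begin
    fold l (f ∘ σ)   ≡⟨ sym (fold-map σ l f) ⟩
    fold (map σ l) f ≡⟨ fold-sameMembers f σl! l! σl⊆l l⊆σl ⟩
    fold l f         ∎
    where
    open ≡-Reasoning
    σl! : Unique (map σ l)
    σl! = Unique.map⁺ (λ {x} {y} σx≡σy → ≡.trans (sym (τσ x)) (≡.trans (cong τ σx≡σy) (τσ y))) l!
    σl⊆l : ∀ {x} → x ∈ map σ l → x ∈ l
    σl⊆l x∈ with ∈.∈-map⁻ σ x∈
    ... | y , y∈l , ≡.refl = σ-closed y∈l
    l⊆σl : ∀ {x} → x ∈ l → x ∈ map σ l
    l⊆σl {x} x∈l = subst (_∈ map σ l) (στ x) (∈.∈-map⁺ σ (τ-closed x∈l))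

  fold-cartesianProduct : ∀ (l : List A) (m : List C) (f : A × C → B) →
                          fold (cartesianProduct l m) f ≡ fold l (λ x → fold m (λ y → f (x , y)))
  fold-cartesianProduct []      m f = ≡.refl
  fold-cartesianProduct (x ∷ l) m f =
    ≡.trans (fold-++ (map (x ,_) m) _ f) (cong₂ _⊕_ (fold-map (x ,_) m f) (fold-cartesianProduct l m f))

  fold-remove : ∀ (_≟_ : DecidableEquality A) {x} {l : List A} (f : A → B) → Unique l → x ∈ l →
                fold l f ≡ f x ⊕ fold (Removal.remove _≟_ x l) f
  fold-remove _≟_ f l! x∈l = fold-↭ f (Removal.↭-remove _≟_ l! x∈l)

module IntegerSum where
  open import Data.Integer using (_+_; _*_; -_; _-_; _≤_; -[1+_])
  open import Data.Integer.Solver using (module +-*-Solver)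
  open +-*-Solver using (solve; _:+_; _:*_; _:-_; _:=_; con)
  open import Data.List.Relation.Unary.All using (lookup)
  open Fold ℤP.+-0-isCommutativeMonoid public using ()
    renaming ( fold to Σ; fold-cong to Σ-cong; fold-distrib to Σ-+; fold-ε to Σ-0
             ; fold-comm to Σ-comm; fold-bijection to Σ-bijection
             ; fold-cartesianProduct to Σ-cartesianProduct; fold-remove to Σ-remove)

  private variable A C : Set

  square-cancel : ∀ {s b} → 0ℤ ≤ s → 0ℤ ≤ b → s * s ≤ b * s → s ≤ b
  square-cancel {+ zero}  _ 0≤b _     = 0≤b
  square-cancel {+ suc k} _ _   ss≤bs = ℤP.*-cancelʳ-≤-pos (+ suc k) _ (+ suc k) ss≤bs

  *-nonneg : ∀ {a b} → 0ℤ ≤ a → 0ℤ ≤ b → 0ℤ ≤ a * b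
  *-nonneg {a} {b} 0≤a 0≤b = subst (_≤ a * b) (ℤP.*-zeroʳ a) (ℤP.*-monoˡ-≤-nonNeg a ⦃ ℤ.nonNegative 0≤a ⦄ 0≤b)

  square-nonneg : ∀ i → 0ℤ ≤ i * i
  square-nonneg (+ n)    = subst (0ℤ ≤_) (ℤP.pos-* n n) (+≤+ ℕ.z≤n)
  square-nonneg -[1+ n ]   = +≤+ ℕ.z≤n

  Σ-*ˡ : ∀ (l : List A) c (f : A → ℤ) → Σ l (λ x → c * f x) ≡ c * Σ l f
  Σ-*ˡ []      c f = sym (ℤP.*-zeroʳ c)
  Σ-*ˡ (x ∷ l) c f = ≡.trans (cong (_+_ (c * f x)) (Σ-*ˡ l c f)) (sym (ℤP.*-distribˡ-+ c _ _))

  Σ-*ʳ : ∀ (l : List A) (f : A → ℤ) c → Σ l (λ x → f x * c) ≡ Σ l f * c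
  Σ-*ʳ l f c = ≡.trans (Σ-cong l (λ {x} _ → ℤP.*-comm (f x) c)) (≡.trans (Σ-*ˡ l c f) (ℤP.*-comm c _))

  Σ-neg : ∀ (l : List A) (f : A → ℤ) → Σ l (λ x → - f x) ≡ - Σ l f
  Σ-neg []      f = ≡.refl
  Σ-neg (x ∷ l) f = ≡.trans (cong (_+_ (- f x)) (Σ-neg l f)) (sym (ℤP.neg-distrib-+ (f x) _))

  Σ-difference : ∀ (l : List A) (f g : A → ℤ) → Σ l (λ x → f x - g x) ≡ Σ l f - Σ l g
  Σ-difference l f g = ≡.trans (Σ-+ l f (λ x → - g x)) (cong (_+_ (Σ l f)) (Σ-neg l g))

  Σ-const : ∀ (l : List A) c → Σ l (λ _ → c) ≡ + length l * c
  Σ-const []      c = sym (ℤP.*-zeroˡ c)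
  Σ-const (_ ∷ l) c = ≡.trans (cong (_+_ c) (Σ-const l c)) (sym (ℤP.suc-* (+ length l) c))

  Σ-* : ∀ (l : List A) (m : List C) (f : A → ℤ) (g : C → ℤ) →
        Σ l f * Σ m g ≡ Σ l (λ x → Σ m (λ y → f x * g y))
  Σ-* l m f g = sym (≡.trans (Σ-cong l (λ {x} _ → Σ-*ˡ m (f x) g)) (Σ-*ʳ l f (Σ m g)))

  Σ-nonneg : ∀ (l : List A) (f : A → ℤ) → (∀ {x} → x ∈ l → 0ℤ ≤ f x) → 0ℤ ≤ Σ l f
  Σ-nonneg []      f f≥0 = ℤP.≤-refl
  Σ-nonneg (x ∷ l) f f≥0 = ℤP.+-mono-≤ (f≥0 (here ≡.refl)) (Σ-nonneg l f (f≥0 ∘ there))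

  module WithDecidableEquality (_≟_ : DecidableEquality A) where
    open Removal _≟_

    Σ-mono-⊆ : ∀ {l m : List A} (f : A → ℤ) → Unique l → Unique m → (∀ {x} → x ∈ l → x ∈ m) →
               (∀ {x} → x ∈ m → 0ℤ ≤ f x) → Σ l f ≤ Σ m f
    Σ-mono-⊆ {[]}    {m} f _           _  _   f≥0 = Σ-nonneg m f f≥0
    Σ-mono-⊆ {x ∷ l} {m} f (x∉l ∷ l!) m! l⊆m f≥0 = begin
      f x + Σ l f
        ≤⟨ ℤP.+-monoʳ-≤ (f x) (Σ-mono-⊆ f l! (remove-unique m!) l⊆m∖x (f≥0 ∘ proj₁ ∘ ∈-remove⁻ m)) ⟩
      f x + Σ (remove x m) f
        ≡⟨ Σ-remove _≟_ f m! (l⊆m (here ≡.refl)) ⟨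
      Σ m f                  ∎
      where
      open ℤP.≤-Reasoning
      l⊆m∖x : ∀ {z} → z ∈ l → z ∈ remove x m
      l⊆m∖x z∈l = ∈-remove⁺ (l⊆m (there z∈l)) (λ z≡x → lookup x∉l z∈l (sym z≡x))

    term≤Σ : ∀ {l : List A} (f : A → ℤ) → Unique l → (∀ {x} → x ∈ l → 0ℤ ≤ f x) →
             ∀ {x} → x ∈ l → f x ≤ Σ l f
    term≤Σ f l! f≥0 {x} x∈l = ℤP.≤-trans (ℤP.≤-reflexive (sym (ℤP.+-identityʳ (f x))))
      (Σ-mono-⊆ f (¬Any⇒All¬ [] (λ ()) ∷ Unique.[]) l! (λ { (here ≡.refl) → x∈l }) f≥0)

    length-mono-⊆ : ∀ {l m : List A} → Unique l → Unique m → (∀ {x} → x ∈ l → x ∈ m) → length l ℕ.≤ length m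
    length-mono-⊆ {l} {m} l! m! l⊆m =
      ℤP.drop‿+≤+ (subst₂ _≤_ (Σ-1 l) (Σ-1 m) (Σ-mono-⊆ (λ _ → 1ℤ) l! m! l⊆m (λ _ → +≤+ ℕ.z≤n)))
      where
      Σ-1 : ∀ l → Σ l (λ _ → 1ℤ) ≡ + length l
      Σ-1 l = ≡.trans (Σ-const l 1ℤ) (ℤP.*-identityʳ _)

    δ : A → A → ℤ
    δ x y with x ≟ y
    ... | yes _ = 1ℤ
    ... | no  _ = 0ℤ

    δ-refl : ∀ x → δ x x ≡ 1ℤ
    δ-refl x with x ≟ x
    ... | yes _   = ≡.refl
    ... | no  x≢x = ⊥-elim (x≢x ≡.refl)

    δ-≢ : ∀ {x y} → x ≢ y → δ x y ≡ 0ℤ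
    δ-≢ {x} {y} x≢y with x ≟ y
    ... | yes x≡y = ⊥-elim (x≢y x≡y)
    ... | no  _   = ≡.refl

    δ-cases : ∀ x y → (x ≡ y × δ x y ≡ 1ℤ) ⊎ (x ≢ y × δ x y ≡ 0ℤ)
    δ-cases x y with x ≟ y
    ... | yes x≡y = inj₁ (x≡y , ≡.refl)
    ... | no  x≢y = inj₂ (x≢y , ≡.refl)

    δ-idem : ∀ x y → δ x y * δ x y ≡ δ x y
    δ-idem x y with x ≟ y
    ... | yes _ = ≡.refl
    ... | no  _ = ≡.refl

    Σ-δ : ∀ {l : List A} (g : A → ℤ) → Unique l → ∀ {r} → r ∈ l → Σ l (λ x → g x * δ x r) ≡ g r
    Σ-δ {l} g l! {r} r∈l = begin
      Σ l (λ x → g x * δ x r)                        ≡⟨ Σ-remove _≟_ _ l! r∈l ⟩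
      g r * δ r r + Σ (remove r l) (λ x → g x * δ x r) ≡⟨ cong₂ (λ u v → g r * u + v) (δ-refl r) off-diagonal ⟩
      g r * 1ℤ + 0ℤ                                  ≡⟨ ≡.trans (ℤP.+-identityʳ _) (ℤP.*-identityʳ (g r)) ⟩
      g r                                            ∎
      where
      open ≡-Reasoning
      off-diagonal : Σ (remove r l) (λ x → g x * δ x r) ≡ 0ℤ
      off-diagonal = ≡.trans
        (Σ-cong (remove r l) (λ x∈ → ≡.trans (cong (g _ *_) (δ-≢ (proj₂ (∈-remove⁻ l x∈)))) (ℤP.*-zeroʳ (g _))))
        (Σ-0 (remove r l))

    Σ-δ-quadratic : ∀ {l : List A} (h : A → ℤ) (c d : ℤ) → Unique l →
                    Σ l (λ x → Σ l (λ y → (h x * h y) * (c * δ y x - d))) ≡ c * Σ l (λ x → h x * h x) - d * (Σ l h * Σ l h)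
    Σ-δ-quadratic {l} h c d l! = begin
      Σ l (λ x → Σ l (λ y → (h x * h y) * (c * δ y x - d)))
        ≡⟨ Σ-cong l (λ {x} _ → ≡.trans (Σ-cong l (λ {y} _ → expand x y)) (Σ-difference l _ _)) ⟩
      Σ l (λ x → Σ l (λ y → (c * h x * h y) * δ y x) - Σ l (λ y → (d * h x) * h y))
        ≡⟨ Σ-cong l (λ {x} x∈l → cong₂ _-_ (Σ-δ (λ y → c * h x * h y) l! x∈l) (Σ-*ˡ l (d * h x) h)) ⟩
      Σ l (λ x → c * h x * h x - d * h x * Σ l h)
        ≡⟨ Σ-difference l _ _ ⟩
      Σ l (λ x → c * h x * h x) - Σ l (λ x → d * h x * Σ l h)
        ≡⟨ cong₂ _-_ (≡.trans (Σ-cong l (λ {x} _ → ℤP.*-assoc c (h x) (h x))) (Σ-*ˡ l c _))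
                     (≡.trans (Σ-*ʳ l (λ x → d * h x) (Σ l h)) (cong (_* Σ l h) (Σ-*ˡ l d h))) ⟩
      c * Σ l (λ x → h x * h x) - d * Σ l h * Σ l h
        ≡⟨ cong (_-_ (c * Σ l (λ x → h x * h x))) (ℤP.*-assoc d _ _) ⟩
      c * Σ l (λ x → h x * h x) - d * (Σ l h * Σ l h) ∎
      where
      open ≡-Reasoning
      expand : ∀ x y → (h x * h y) * (c * δ y x - d) ≡ (c * h x * h y) * δ y x - (d * h x) * h y
      expand x y = solve 5 (λ a b c e d → (a :* b) :* (c :* e :- d) := (c :* a :* b) :* e :- (d :* a) :* b)
                           ≡.refl (h x) (h y) c (δ y x) d

  Σ-deviation² : ∀ c (l : List A) (X : A → ℤ) →
                 Σ l (λ y → (c - X y) * (c - X y)) ≡ + length l * (c * c) - + 2 * c * Σ l X + Σ l (λ y → X y * X y)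
  Σ-deviation² c []      X = solve 1 (λ c → con 0ℤ := con 0ℤ :* (c :* c) :- con (+ 2) :* c :* con 0ℤ :+ con 0ℤ) ≡.refl c
  Σ-deviation² c (x ∷ l) X = ≡.trans (cong (_+_ ((c - X x) * (c - X x))) (Σ-deviation² c l X))
    (solve 5 (λ c y n S Q → (c :- y) :* (c :- y) :+ (n :* (c :* c) :- con (+ 2) :* c :* S :+ Q)
                         := (con 1ℤ :+ n) :* (c :* c) :- con (+ 2) :* c :* (y :+ S) :+ (y :* y :+ Q))
           ≡.refl c (X x) (+ length l) (Σ l X) (Σ l (λ y → X y * X y)))

  cauchy-schwarz : ∀ (l : List A) (X : A → ℤ) → Σ l X * Σ l X ≤ + length l * Σ l (λ y → X y * X y)
  cauchy-schwarz []      X = ℤP.≤-refl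
  cauchy-schwarz (x ∷ l) X = ℤP.0≤i-j⇒j≤i (ℤP.≤-trans
      (ℤP.+-mono-≤ (ℤP.i≤j⇒0≤j-i (cauchy-schwarz l X)) (Σ-nonneg l _ (λ {y} _ → square-nonneg (X x - X y))))
      (ℤP.≤-reflexive gap))
    where
    n S Q : ℤ
    n = + length l
    S = Σ l X
    Q = Σ l (λ y → X y * X y)
    gap : (n * Q - S * S) + Σ l (λ y → (X x - X y) * (X x - X y)) ≡ (1ℤ + n) * (X x * X x + Q) - (X x + S) * (X x + S)
    gap = ≡.trans (cong (_+_ (n * Q - S * S)) (Σ-deviation² (X x) l X))
      (solve 4 (λ c n S Q → (n :* Q :- S :* S) :+ (n :* (c :* c) :- con (+ 2) :* c :* S :+ Q)
                         := (con 1ℤ :+ n) :* (c :* c :+ Q) :- (c :+ S) :* (c :+ S)) ≡.refl (X x) n S Q)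

module FieldFacts (F : FiniteField) where
  open FiniteField F public using (Carrier; _≟_; 0#; 1#; elements; elements-unique; elements-complete; order)
  open FiniteField F using (0≢1; inverse; isCommutativeRing)

  ring : CommutativeRing 0ℓ 0ℓ
  ring = record { isCommutativeRing = isCommutativeRing }

  open CommutativeRing ring public
    using ( +-assoc; +-comm; +-identityˡ; +-identityʳ; -‿inverseʳ; *-isCommutativeMonoid
          ; *-assoc; *-comm; *-identityˡ; *-identityʳ; zeroʳ)
    renaming (_+_ to _⊞_; _*_ to _·_; _-_ to _⊟_; -_ to ⊟_)
  open IntegerCoefficientSolver ring public using (solve; _:+_; _:*_; _:-_; :-_; _:=_; con)
  open Exp (CommutativeRing.semiring ring) public using (_^_; ^-homo-*; ^-assocʳ)
  open Removal _≟_ public using (remove; ∈-remove⁺; ∈-remove⁻; remove-unique; ↭-remove)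

  1≢0 : 1# ≢ 0#
  1≢0 = 0≢1 ∘ sym

  inv : (x : Carrier) → x ≢ 0# → Carrier
  inv x x≢0 = proj₁ (inverse x x≢0)

  ·-inverseʳ : ∀ x (x≢0 : x ≢ 0#) → x · inv x x≢0 ≡ 1#
  ·-inverseʳ x x≢0 = proj₂ (inverse x x≢0)

  ·-inverseˡ : ∀ x (x≢0 : x ≢ 0#) → inv x x≢0 · x ≡ 1#
  ·-inverseˡ x x≢0 = ≡.trans (*-comm _ x) (·-inverseʳ x x≢0)

  inv-·-cancelˡ : ∀ a (a≢0 : a ≢ 0#) x → inv a a≢0 · (a · x) ≡ x
  inv-·-cancelˡ a a≢0 x = begin
    inv a a≢0 · (a · x) ≡⟨ *-assoc _ a x ⟨
    (inv a a≢0 · a) · x ≡⟨ cong (_· x) (·-inverseˡ a a≢0) ⟩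
    1# · x              ≡⟨ *-identityˡ x ⟩
    x                   ∎
    where open ≡-Reasoning

  ·-cancelˡ : ∀ {a x y} → a ≢ 0# → a · x ≡ a · y → x ≡ y
  ·-cancelˡ {a} {x} {y} a≢0 ax≡ay =
    ≡.trans (sym (inv-·-cancelˡ a a≢0 x)) (≡.trans (cong (inv a a≢0 ·_) ax≡ay) (inv-·-cancelˡ a a≢0 y))

  ·-nonzero : ∀ {x y} → x ≢ 0# → y ≢ 0# → x · y ≢ 0#
  ·-nonzero {x} x≢0 y≢0 xy≡0 = y≢0 (·-cancelˡ x≢0 (≡.trans xy≡0 (sym (zeroʳ x))))

  inv-nonzero : ∀ x (x≢0 : x ≢ 0#) → inv x x≢0 ≢ 0#
  inv-nonzero x x≢0 x⁻¹≡0 = 1≢0 (begin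
    1#            ≡⟨ ·-inverseʳ x x≢0 ⟨
    x · inv x x≢0 ≡⟨ cong (x ·_) x⁻¹≡0 ⟩
    x · 0#        ≡⟨ zeroʳ x ⟩
    0#            ∎)
    where open ≡-Reasoning

  ⊟≡0⇒≡ : ∀ {x y} → x ⊟ y ≡ 0# → x ≡ y
  ⊟≡0⇒≡ {x} {y} x-y≡0 = begin
    x              ≡⟨ solve 2 (λ x y → x := (x :- y) :+ y) ≡.refl x y ⟩
    (x ⊟ y) ⊞ y    ≡⟨ cong (_⊞ y) x-y≡0 ⟩
    0# ⊞ y         ≡⟨ +-identityˡ y ⟩
    y              ∎
    where open ≡-Reasoning

  ⊞-cancelˡ : ∀ x {y z} → x ⊞ y ≡ x ⊞ z → y ≡ z
  ⊞-cancelˡ x {y} {z} x+y≡x+z = begin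
    y              ≡⟨ solve 2 (λ x y → y := (x :+ y) :- x) ≡.refl x y ⟩
    (x ⊞ y) ⊟ x    ≡⟨ cong (_⊟ x) x+y≡x+z ⟩
    (x ⊞ z) ⊟ x    ≡⟨ solve 2 (λ x z → (x :+ z) :- x := z) ≡.refl x z ⟩
    z              ∎
    where open ≡-Reasoning

  ^-nonzero : ∀ {x} n → x ≢ 0# → x ^ n ≢ 0#
  ^-nonzero zero    x≢0 = 1≢0
  ^-nonzero (suc n) x≢0 = ·-nonzero x≢0 (^-nonzero n x≢0)

  1^n≡1 : ∀ n → 1# ^ n ≡ 1#
  1^n≡1 zero    = ≡.refl
  1^n≡1 (suc n) = ≡.trans (*-identityˡ _) (1^n≡1 n)

  units : List Carrier
  units = remove 0# elements

  units-unique : Unique units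
  units-unique = remove-unique elements-unique

  ∈-units : ∀ {x} → x ≢ 0# → x ∈ units
  ∈-units x≢0 = ∈-remove⁺ (elements-complete _) x≢0

  units-nonzero : ∀ {x} → x ∈ units → x ≢ 0#
  units-nonzero x∈ = proj₂ (∈-remove⁻ elements x∈)

  N : ℕ
  N = order ℕ.∸ 1

  N≡|units| : N ≡ length units
  N≡|units| = cong (ℕ._∸ 1) (↭.↭-length (↭-remove elements-unique (elements-complete 0#)))

  order≡1+N : order ≡ suc N
  order≡1+N = ≡.trans (↭.↭-length (↭-remove elements-unique (elements-complete 0#))) (cong suc (sym N≡|units|))

  1≤N : 1 ℕ.≤ N
  1≤N = subst (1 ℕ.≤_) (sym N≡|units|) (nonempty (∈-units 1≢0))
    where
    nonempty : ∀ {x} {l : List Carrier} → x ∈ l → 1 ℕ.≤ length l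
    nonempty (here _)  = ℕ.s≤s ℕ.z≤n
    nonempty (there _) = ℕ.s≤s ℕ.z≤n

  module Π = Fold *-isCommutativeMonoid

  Π-scale : ∀ x (l : List Carrier) → Π.fold l (x ·_) ≡ x ^ length l · Π.fold l (λ u → u)
  Π-scale x []      = sym (*-identityˡ 1#)
  Π-scale x (u ∷ l) = ≡.trans (cong ((x · u) ·_) (Π-scale x l))
    (solve 4 (λ x u p q → (x :* u) :* (p :* q) := (x :* p) :* (u :* q)) ≡.refl x u _ _)

  -- Multiplication by x permutes the units.
  fermat : ∀ x → x ≢ 0# → x ^ N ≡ 1#
  fermat x x≢0 = sym (·-cancelˡ P≢0 (begin
    P · 1#                    ≡⟨ *-identityʳ P ⟩
    P                         ≡⟨ Π.fold-bijection (x ·_) (inv x x≢0 ·_) units-unique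
                                   (λ u∈ → ∈-units (·-nonzero x≢0 (units-nonzero u∈)))
                                   (λ u∈ → ∈-units (·-nonzero (inv-nonzero x x≢0) (units-nonzero u∈)))
                                   (inv-·-cancelˡ x x≢0) x·x⁻¹· (λ u → u) ⟨
    Π.fold units (x ·_)       ≡⟨ Π-scale x units ⟩
    x ^ length units · P      ≡⟨ cong (λ k → x ^ k · P) (sym N≡|units|) ⟩
    x ^ N · P                 ≡⟨ *-comm _ P ⟩
    P · x ^ N                 ∎))
    where
    open ≡-Reasoning
    P : Carrier
    P = Π.fold units (λ u → u)
    P≢0 : P ≢ 0#
    P≢0 = nonzero units units-nonzero
      where
      nonzero : ∀ (l : List Carrier) → (∀ {u} → u ∈ l → u ≢ 0#) → Π.fold l (λ u → u) ≢ 0#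
      nonzero []      _   = 1≢0
      nonzero (u ∷ l) l≢0 = ·-nonzero (l≢0 (here ≡.refl)) (nonzero l (l≢0 ∘ there))
    x·x⁻¹· : ∀ u → x · (inv x x≢0 · u) ≡ u
    x·x⁻¹· u = ≡.trans (sym (*-assoc x _ u)) (≡.trans (cong (_· u) (·-inverseʳ x x≢0)) (*-identityˡ u))

  instance
    N-nonZero : ℕ.NonZero N
    N-nonZero = ℕ.>-nonZero 1≤N

  ·-^[N∸1] : ∀ x → x ≢ 0# → x · x ^ (N ℕ.∸ 1) ≡ 1#
  ·-^[N∸1] x x≢0 = ≡.trans (cong (x ^_) (ℕP.suc-pred N)) (fermat x x≢0)

  ^-mod-N : ∀ {x} → x ≢ 0# → ∀ i → x ^ i ≡ x ^ (i % N)
  ^-mod-N {x} x≢0 i = begin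
    x ^ i                                ≡⟨ cong (x ^_) (m≡m%n+[m/n]*n i N) ⟩
    x ^ (i % N ℕ.+ (i / N) ℕ.* N)        ≡⟨ ^-homo-* x (i % N) _ ⟩
    x ^ (i % N) · x ^ ((i / N) ℕ.* N)    ≡⟨ cong (λ k → x ^ (i % N) · x ^ k) (ℕP.*-comm (i / N) N) ⟩
    x ^ (i % N) · x ^ (N ℕ.* (i / N))    ≡⟨ cong (x ^ (i % N) ·_) (^-assocʳ x N (i / N)) ⟨
    x ^ (i % N) · (x ^ N) ^ (i / N)      ≡⟨ cong (λ y → x ^ (i % N) · y ^ (i / N)) (fermat x x≢0) ⟩
    x ^ (i % N) · 1# ^ (i / N)           ≡⟨ cong (x ^ (i % N) ·_) (1^n≡1 (i / N)) ⟩
    x ^ (i % N) · 1#                     ≡⟨ *-identityʳ _ ⟩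
    x ^ (i % N)                          ∎
    where open ≡-Reasoning

module Characters (F : FiniteField) where
  open FieldFacts F
  open Affine F using (MultCharacter; NonTrivial; IsTrivialValue)
  open import Data.Integer using (_+_; _*_; -_; _-_)
  open import Data.Integer.Divisibility.Signed using (_∣_; divides; ∣⇒∣ᵤ; ∣ᵤ⇒∣; ∣m∣n⇒∣m+n; ∣m⇒∣-m; ∣n⇒∣m*n)
  open import Data.Integer.Solver using (module +-*-Solver)
  open import Data.List.Membership.DecPropositional _≟_ using (_∈?_)
  open import Data.List.Membership.Propositional using (find; lose)
  open import Data.List.Relation.Unary.Any using (any?)
  open import Data.List.Relation.Unary.All as All using (All; []; _∷_)
  open import Data.List using (upTo)
  open import Data.Nat.Divisibility using (∣⇒≤)
  module Z = +-*-Solver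

  -- Character values are discrete logarithms (see MultCharacter), compared modulo N = q - 1.
  infix 4 _≋_
  record _≋_ (a b : ℤ) : Set where
    constructor congruent
    field N∣a-b : + N ∣ a - b

  private
    ∣-resp : ∀ {a b} → a ≡ b → + N ∣ a → + N ∣ b
    ∣-resp = subst (+ N ∣_)

  ≋-reflexive : ∀ {a b} → a ≡ b → a ≋ b
  ≋-reflexive {a} ≡.refl = congruent (∣-resp (sym (ℤP.+-inverseʳ a)) (divides 0ℤ ≡.refl))

  ≋-refl : ∀ {a} → a ≋ a
  ≋-refl = ≋-reflexive ≡.refl

  ≋-sym : ∀ {a b} → a ≋ b → b ≋ a
  ≋-sym {a} {b} (congruent a≋b) =
    congruent (∣-resp (Z.solve 2 (λ a b → Z.:- (a Z.:- b) Z.:= b Z.:- a) ≡.refl a b) (∣m⇒∣-m a≋b))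

  ≋-trans : ∀ {a b c} → a ≋ b → b ≋ c → a ≋ c
  ≋-trans {a} {b} {c} (congruent a≋b) (congruent b≋c) =
    congruent (∣-resp (Z.solve 3 (λ a b c → (a Z.:- b) Z.:+ (b Z.:- c) Z.:= a Z.:- c) ≡.refl a b c) (∣m∣n⇒∣m+n a≋b b≋c))

  ≋-+ : ∀ {a b c d} → a ≋ b → c ≋ d → a + c ≋ b + d
  ≋-+ {a} {b} {c} {d} (congruent a≋b) (congruent c≋d) = congruent
    (∣-resp (Z.solve 4 (λ a b c d → (a Z.:- b) Z.:+ (c Z.:- d) Z.:= (a Z.:+ c) Z.:- (b Z.:+ d)) ≡.refl a b c d)
            (∣m∣n⇒∣m+n a≋b c≋d))

  ≋-*ˡ : ∀ c {a b} → a ≋ b → c * a ≋ c * b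
  ≋-*ˡ c {a} {b} (congruent a≋b) =
    congruent (∣-resp (Z.solve 3 (λ c a b → c Z.:* (a Z.:- b) Z.:= c Z.:* a Z.:- c Z.:* b) ≡.refl c a b) (∣n⇒∣m*n c a≋b))

  ≋-setoid : Setoid 0ℓ 0ℓ
  ≋-setoid = record
    { Carrier = ℤ ; _≈_ = _≋_
    ; isEquivalence = record { refl = ≋-refl ; sym = ≋-sym ; trans = ≋-trans } }

  module ≋-Reasoning = Relation.Binary.Reasoning.Setoid ≋-setoid

  ≋0⇒∣ : ∀ {a} → a ≋ 0ℤ → + N ∣ a
  ≋0⇒∣ {a} (congruent N∣a-0) = ∣-resp (ℤP.+-identityʳ a) N∣a-0

  ∣⇒≋0 : ∀ {a} → + N ∣ a → a ≋ 0ℤ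
  ∣⇒≋0 {a} N∣a = congruent (∣-resp (sym (ℤP.+-identityʳ a)) N∣a)

  record PartialCharacter : Set where
    field
      domain          : List Carrier
      χ               : Carrier → ℤ
      domain-nonzero  : ∀ {x} → x ∈ domain → x ≢ 0#
      1∈domain        : 1# ∈ domain
      domain-·-closed : ∀ {x y} → x ∈ domain → y ∈ domain → x · y ∈ domain
      χ-homo          : ∀ {x y} → x ∈ domain → y ∈ domain → χ (x · y) ≋ χ x + χ y

    χ-1 : χ 1# ≋ 0ℤ
    χ-1 = begin
      χ 1#                    ≡⟨ Z.solve 1 (λ c → c Z.:= (c Z.:+ c) Z.:- c) ≡.refl (χ 1#) ⟩
      (χ 1# + χ 1#) - χ 1#    ≈⟨ ≋-+ (≋-sym χ1≋χ1+χ1) ≋-refl ⟩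
      χ 1# - χ 1#             ≡⟨ ℤP.+-inverseʳ (χ 1#) ⟩
      0ℤ                      ∎
      where
      open ≋-Reasoning
      χ1≋χ1+χ1 : χ 1# ≋ χ 1# + χ 1#
      χ1≋χ1+χ1 = subst (λ z → χ z ≋ χ 1# + χ 1#) (*-identityˡ 1#) (χ-homo 1∈domain 1∈domain)

    ^-closed : ∀ {x} n → x ∈ domain → x ^ n ∈ domain
    ^-closed zero    _   = 1∈domain
    ^-closed (suc n) x∈D = domain-·-closed x∈D (^-closed n x∈D)

    χ-^ : ∀ {x} n → x ∈ domain → χ (x ^ n) ≋ + n * χ x
    χ-^ {x} zero    _   = ≋-trans χ-1 (≋-reflexive (sym (ℤP.*-zeroˡ (χ x))))
    χ-^ {x} (suc n) x∈D = begin
      χ (x · x ^ n)         ≈⟨ χ-homo x∈D (^-closed n x∈D) ⟩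
      χ x + χ (x ^ n)       ≈⟨ ≋-+ (≋-refl {χ x}) (χ-^ n x∈D) ⟩
      χ x + + n * χ x       ≡⟨ ℤP.suc-* (+ n) (χ x) ⟨
      + suc n * χ x         ∎
      where open ≋-Reasoning

    factor-closed : ∀ {z k} → k ∈ domain → z · k ∈ domain → z ∈ domain
    factor-closed {z} {k} k∈D zk∈D = subst (_∈ domain) zk·k⁻¹≡z (domain-·-closed zk∈D (^-closed (N ℕ.∸ 1) k∈D))
      where
      zk·k⁻¹≡z : (z · k) · k ^ (N ℕ.∸ 1) ≡ z
      zk·k⁻¹≡z = begin
        (z · k) · k ^ (N ℕ.∸ 1) ≡⟨ *-assoc z k _ ⟩
        z · (k · k ^ (N ℕ.∸ 1)) ≡⟨ cong (z ·_) (·-^[N∸1] k (domain-nonzero k∈D)) ⟩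
        z · 1#                  ≡⟨ *-identityʳ z ⟩
        z                       ∎
        where open ≡-Reasoning

  -- Extends P to the subgroup generated by its domain and y, by χ′ (yⁱ k) = i t + χ k;
  -- compatibility of t makes this independent of the representation (representations-agree).
  module Extension (P : PartialCharacter) (y : Carrier) (y≢0 : y ≢ 0#) (t : ℤ)
                   (compatible : ∀ r → y ^ r ∈ PartialCharacter.domain P → PartialCharacter.χ P (y ^ r) ≋ + r * t) where
    open PartialCharacter P

    record Representation (x : Carrier) (i : ℕ) (k : Carrier) : Set where
      constructor representation
      field
        k∈domain : k ∈ domain
        y^i·k≡x  : y ^ i · k ≡ x

    pairs : List (ℕ × Carrier)
    pairs = cartesianProduct (upTo N) domain

    value : ℕ × Carrier → Carrier
    value (i , k) = y ^ i · k

    domain′ : List Carrier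
    domain′ = map value pairs

    χ′ : Carrier → ℤ
    χ′ x with any? (λ p → value p ≟ x) pairs
    ... | yes found = let ((i , k) , _ , _) = find found in + i * t + χ k
    ... | no  _     = 0ℤ

    shift : ∀ {x i k i′ k′} → i′ ℕ.≤ i → Representation x i k → Representation x i′ k′ →
            y ^ (i ℕ.∸ i′) · k ≡ k′
    shift {x} {i} {k} {i′} {k′} i′≤i (representation _ y^i·k≡x) (representation _ y^i′·k′≡x) =
      ·-cancelˡ (^-nonzero i′ y≢0) (begin
        y ^ i′ · (y ^ r · k)   ≡⟨ *-assoc _ _ k ⟨
        (y ^ i′ · y ^ r) · k   ≡⟨ cong (_· k) (^-homo-* y i′ r) ⟨
        y ^ (i′ ℕ.+ r) · k     ≡⟨ cong (λ n → y ^ n · k) (ℕP.m+[n∸m]≡n i′≤i) ⟩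
        y ^ i · k              ≡⟨ ≡.trans y^i·k≡x (sym y^i′·k′≡x) ⟩
        y ^ i′ · k′            ∎)
      where
      open ≡-Reasoning
      r : ℕ
      r = i ℕ.∸ i′

    representations-agree-≤ : ∀ {x i k i′ k′} → i′ ℕ.≤ i → Representation x i k → Representation x i′ k′ →
                              + i * t + χ k ≋ + i′ * t + χ k′
    representations-agree-≤ {x} {i} {k} {i′} {k′} i′≤i ρ@(representation k∈D _) ρ′@(representation k′∈D _) = begin
      + i * t + χ k
        ≡⟨ cong (λ n → + n * t + χ k) (ℕP.m+[n∸m]≡n i′≤i) ⟨
      + (i′ ℕ.+ r) * t + χ k
        ≡⟨ cong (λ n → n * t + χ k) (ℤP.pos-+ i′ r) ⟩
      (+ i′ + + r) * t + χ k
        ≡⟨ Z.solve 4 (λ a b t c → (a Z.:+ b) Z.:* t Z.:+ c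
                         Z.:= a Z.:* t Z.:+ (b Z.:* t Z.:+ c)) ≡.refl (+ i′) (+ r) t (χ k) ⟩
      + i′ * t + (+ r * t + χ k)
        ≈⟨ ≋-+ (≋-refl {+ i′ * t}) (≋-sym χk′≋) ⟩
      + i′ * t + χ k′              ∎
      where
      open ≋-Reasoning
      r : ℕ
      r = i ℕ.∸ i′
      y^r∈D : y ^ r ∈ domain
      y^r∈D = factor-closed k∈D (subst (_∈ domain) (sym (shift i′≤i ρ ρ′)) k′∈D)
      χk′≋ : χ k′ ≋ + r * t + χ k
      χk′≋ = begin
        χ k′               ≡⟨ cong χ (shift i′≤i ρ ρ′) ⟨
        χ (y ^ r · k)      ≈⟨ χ-homo y^r∈D k∈D ⟩
        χ (y ^ r) + χ k    ≈⟨ ≋-+ (compatible r y^r∈D) ≋-refl ⟩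
        + r * t + χ k      ∎

    representations-agree : ∀ {x i k i′ k′} → Representation x i k → Representation x i′ k′ →
                            + i * t + χ k ≋ + i′ * t + χ k′
    representations-agree {i = i} {i′ = i′} ρ ρ′ with ℕP.≤-total i′ i
    ... | inj₁ i′≤i = representations-agree-≤ i′≤i ρ ρ′
    ... | inj₂ i≤i′ = ≋-sym (representations-agree-≤ i≤i′ ρ′ ρ)

    reduced : ∀ {x i k} → Representation x i k → (i % N , k) ∈ pairs × value (i % N , k) ≡ x
    reduced {i = i} {k} (representation k∈D y^i·k≡x) =
      ∈.∈-cartesianProduct⁺ (∈.∈-upTo⁺ (m%n<n i N)) k∈D , ≡.trans (cong (_· k) (sym (^-mod-N y≢0 i))) y^i·k≡x

    ∈-domain′ : ∀ {x i k} → Representation x i k → x ∈ domain′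
    ∈-domain′ ρ = subst (_∈ domain′) (proj₂ (reduced ρ)) (∈.∈-map⁺ value (proj₁ (reduced ρ)))

    representation-of : ∀ {x} → x ∈ domain′ → ∃[ i ] ∃[ k ] Representation x i k
    representation-of x∈ with ∈.∈-map⁻ value x∈
    ... | (i , k) , p∈ , x≡ = i , k , representation (proj₂ (∈.∈-cartesianProduct⁻ (upTo N) domain p∈)) (sym x≡)

    χ′-representation : ∀ {x i k} → Representation x i k → χ′ x ≋ + i * t + χ k
    χ′-representation {x} ρ with any? (λ p → value p ≟ x) pairs
    ... | yes found = representations-agree ρ₀ ρ
      where
      ρ₀ : Representation x (proj₁ (proj₁ (find found))) (proj₂ (proj₁ (find found)))
      ρ₀ = representation (proj₂ (∈.∈-cartesianProduct⁻ (upTo N) domain (proj₁ (proj₂ (find found)))))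
                          (proj₂ (proj₂ (find found)))
    ... | no none = ⊥-elim (none (lose (proj₁ (reduced ρ)) (proj₂ (reduced ρ))))

    representation-· : ∀ {x i k x′ i′ k′} → Representation x i k → Representation x′ i′ k′ →
                       Representation (x · x′) (i ℕ.+ i′) (k · k′)
    representation-· {x} {i} {k} {x′} {i′} {k′} (representation k∈D y^i·k≡x) (representation k′∈D y^i′·k′≡x′) =
      representation (domain-·-closed k∈D k′∈D) (begin
        y ^ (i ℕ.+ i′) · (k · k′)
          ≡⟨ cong (_· (k · k′)) (^-homo-* y i i′) ⟩
        (y ^ i · y ^ i′) · (k · k′)
          ≡⟨ solve 4 (λ a b c d → (a :* b) :* (c :* d) := (a :* c) :* (b :* d)) ≡.refl (y ^ i) (y ^ i′) k k′ ⟩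
        (y ^ i · k) · (y ^ i′ · k′)
          ≡⟨ cong₂ _·_ y^i·k≡x y^i′·k′≡x′ ⟩
        x · x′                          ∎)
      where open ≡-Reasoning

    χ′-homo : ∀ {x x′} → x ∈ domain′ → x′ ∈ domain′ → χ′ (x · x′) ≋ χ′ x + χ′ x′
    χ′-homo x∈ x′∈ with representation-of x∈ | representation-of x′∈
    ... | i , k , ρ | i′ , k′ , ρ′ = begin
      χ′ (_ · _)
        ≈⟨ χ′-representation (representation-· ρ ρ′) ⟩
      + (i ℕ.+ i′) * t + χ (k · k′)
        ≈⟨ ≋-+ (≋-refl {+ (i ℕ.+ i′) * t}) (χ-homo (Representation.k∈domain ρ) (Representation.k∈domain ρ′)) ⟩
      + (i ℕ.+ i′) * t + (χ k + χ k′)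
        ≡⟨ cong (λ n → n * t + (χ k + χ k′)) (ℤP.pos-+ i i′) ⟩
      (+ i + + i′) * t + (χ k + χ k′)
        ≡⟨ Z.solve 5 (λ a b t c d → (a Z.:+ b) Z.:* t Z.:+ (c Z.:+ d)
                         Z.:= (a Z.:* t Z.:+ c) Z.:+ (b Z.:* t Z.:+ d)) ≡.refl (+ i) (+ i′) t (χ k) (χ k′) ⟩
      (+ i * t + χ k) + (+ i′ * t + χ k′)
        ≈⟨ ≋-+ (χ′-representation ρ) (χ′-representation ρ′) ⟨
      χ′ _ + χ′ _                          ∎
      where open ≋-Reasoning

    extension : PartialCharacter
    extension = record
      { domain          = domain′
      ; χ               = χ′
      ; domain-nonzero  = λ x∈ → let (i , k , representation k∈D y^i·k≡x) = representation-of x∈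
                                 in λ x≡0 → ·-nonzero (^-nonzero i y≢0) (domain-nonzero k∈D) (≡.trans y^i·k≡x x≡0)
      ; 1∈domain        = ∈-domain′ {i = 0} (representation 1∈domain (*-identityˡ 1#))
      ; domain-·-closed = λ x∈ x′∈ → let (_ , _ , ρ) = representation-of x∈ ; (_ , _ , ρ′) = representation-of x′∈
                                     in ∈-domain′ (representation-· ρ ρ′)
      ; χ-homo          = χ′-homo
      }

    extension-extends : ∀ {x} → x ∈ domain → x ∈ domain′ × χ′ x ≋ χ x
    extension-extends {x} x∈D = ∈-domain′ ρ , ≋-trans (χ′-representation ρ)
                                  (≋-reflexive (≡.trans (cong (_+ χ x) (ℤP.*-zeroˡ t)) (ℤP.+-identityˡ (χ x))))
      where
      ρ : Representation x 0 x
      ρ = representation x∈D (*-identityˡ x)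

    extension-y : y ∈ domain′ × χ′ y ≋ t
    extension-y = ∈-domain′ ρ , (begin
      χ′ y           ≈⟨ χ′-representation ρ ⟩
      + 1 * t + χ 1# ≈⟨ ≋-+ (≋-refl {+ 1 * t}) χ-1 ⟩
      + 1 * t + 0ℤ   ≡⟨ ≡.trans (ℤP.+-identityʳ _) (ℤP.*-identityˡ t) ⟩
      t              ∎)
      where
      open ≋-Reasoning
      ρ : Representation y 1 1#
      ρ = representation 1∈domain (≡.trans (*-identityʳ _) (*-identityʳ y))

  module Order (P : PartialCharacter) (y : Carrier) (y≢0 : y ≢ 0#) where
    open PartialCharacter P

    y^N∈domain : y ^ N ∈ domain
    y^N∈domain = subst (_∈ domain) (sym (fermat y y≢0)) 1∈domain

    least-period : ∃[ m ] y ^ suc m ∈ domain × (∀ {k} → k ℕ.< m → y ^ suc k ∉ domain)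
    least-period = least-witness (λ m → y ^ suc m ∈? domain) {N ℕ.∸ 1}
                                 (subst (λ n → y ^ n ∈ domain) (sym (ℕP.suc-pred N)) y^N∈domain)

    j : ℕ
    j = suc (proj₁ least-period)

    y^j∈domain : y ^ j ∈ domain
    y^j∈domain = proj₁ (proj₂ least-period)

    y^[q*j] : ∀ q → y ^ (q ℕ.* j) ≡ (y ^ j) ^ q
    y^[q*j] q = ≡.trans (cong (y ^_) (ℕP.*-comm q j)) (sym (^-assocʳ y j q))

    period-divides : ∀ r → y ^ r ∈ domain → r ≡ (r / j) ℕ.* j
    period-divides r y^r∈D with r % j in r%j≡ | m%n<n r j
    ... | zero  | _   = ≡.trans (m≡m%n+[m/n]*n r j) (cong (ℕ._+ (r / j) ℕ.* j) r%j≡)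
    ... | suc s | s<j = ⊥-elim (proj₂ (proj₂ least-period) (ℕP.≤-pred s<j)
                                  (factor-closed (^-closed (r / j) y^j∈domain) (subst (_∈ domain) split y^r∈D)))
      where
      split : y ^ r ≡ y ^ suc s · (y ^ j) ^ (r / j)
      split = begin
        y ^ r                                ≡⟨ cong (y ^_) (m≡m%n+[m/n]*n r j) ⟩
        y ^ (r % j ℕ.+ (r / j) ℕ.* j)        ≡⟨ cong (λ n → y ^ (n ℕ.+ (r / j) ℕ.* j)) r%j≡ ⟩
        y ^ (suc s ℕ.+ (r / j) ℕ.* j)        ≡⟨ ^-homo-* y (suc s) _ ⟩
        y ^ suc s · y ^ ((r / j) ℕ.* j)      ≡⟨ cong (y ^ suc s ·_) (y^[q*j] (r / j)) ⟩
        y ^ suc s · (y ^ j) ^ (r / j)        ∎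
        where open ≡-Reasoning

    compatible-with : ∀ t → + j * t ≋ χ (y ^ j) → ∀ r → y ^ r ∈ domain → χ (y ^ r) ≋ + r * t
    compatible-with t jt≋ r y^r∈D = begin
      χ (y ^ r)              ≡⟨ cong (λ n → χ (y ^ n)) (period-divides r y^r∈D) ⟩
      χ (y ^ (q ℕ.* j))      ≡⟨ cong χ (y^[q*j] q) ⟩
      χ ((y ^ j) ^ q)        ≈⟨ χ-^ q y^j∈domain ⟩
      + q * χ (y ^ j)        ≈⟨ ≋-*ˡ (+ q) jt≋ ⟨
      + q * (+ j * t)        ≡⟨ ℤP.*-assoc (+ q) (+ j) t ⟨
      + q * + j * t          ≡⟨ cong (_* t) (ℤP.pos-* q j) ⟨
      + (q ℕ.* j) * t        ≡⟨ cong (λ n → + n * t) (period-divides r y^r∈D) ⟨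
      + r * t                ∎
      where
      open ≋-Reasoning
      q = r / j

    Q : ℕ
    Q = N / j

    N≡Q*j : N ≡ Q ℕ.* j
    N≡Q*j = period-divides N y^N∈domain

    Q≢0 : Q ≢ 0
    Q≢0 Q≡0 = ℕP.<⇒≢ 1≤N (sym (≡.trans N≡Q*j (cong (ℕ._* j) Q≡0)))

    Q*χ[y^j]≋0 : + Q * χ (y ^ j) ≋ 0ℤ
    Q*χ[y^j]≋0 = begin
      + Q * χ (y ^ j)   ≈⟨ χ-^ Q y^j∈domain ⟨
      χ ((y ^ j) ^ Q)   ≡⟨ cong χ (y^[q*j] Q) ⟨
      χ (y ^ (Q ℕ.* j)) ≡⟨ cong (λ n → χ (y ^ n)) N≡Q*j ⟨
      χ (y ^ N)         ≡⟨ cong χ (fermat y y≢0) ⟩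
      χ 1#              ≈⟨ χ-1 ⟩
      0ℤ                ∎
      where open ≋-Reasoning

    -- j is the order of y modulo the domain and N = Q j, so Q χ(yʲ) ≋ χ(yᴺ) = χ 1 ≋ 0 makes
    -- χ(yʲ) an exact multiple of j.
    solvable : ∃[ t ] + j * t ≋ χ (y ^ j)
    solvable = m , ≋-reflexive (sym (ℤP.*-cancelˡ-≡ (+ Q) c (+ j * m) ⦃ ℕ.≢-nonZero Q≢0 ⦄ Qc≡Q[jm]))
      where
      open ≡-Reasoning
      c m : ℤ
      c = χ (y ^ j)
      m = _∣_.quotient (_≋_.N∣a-b Q*χ[y^j]≋0)
      Qc≡Q[jm] : + Q * c ≡ + Q * (+ j * m)
      Qc≡Q[jm] = begin
        + Q * c              ≡⟨ ℤP.+-identityʳ _ ⟨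
        + Q * c - 0ℤ         ≡⟨ _∣_.equality (_≋_.N∣a-b Q*χ[y^j]≋0) ⟩
        m * + N              ≡⟨ cong (λ n → m * + n) N≡Q*j ⟩
        m * + (Q ℕ.* j)      ≡⟨ cong (m *_) (ℤP.pos-* Q j) ⟩
        m * (+ Q * + j)      ≡⟨ Z.solve 3 (λ m a b → m Z.:* (a Z.:* b) Z.:= a Z.:* (b Z.:* m)) ≡.refl m (+ Q) (+ j) ⟩
        + Q * (+ j * m)      ∎

  module Extend (P : PartialCharacter) (y : Carrier) (y≢0 : y ≢ 0#) where
    open Order P y y≢0 using (solvable; compatible-with)
    open Extension P y y≢0 (proj₁ solvable) (compatible-with (proj₁ solvable) (proj₂ solvable)) public
      using (extension; extension-extends; extension-y)

  open PartialCharacter using (domain; χ)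

  extendAll : (P : PartialCharacter) (xs : List Carrier) → All (_≢ 0#) xs → PartialCharacter
  extendAll P []       []           = P
  extendAll P (x ∷ xs) (x≢0 ∷ xs≢0) = extendAll (Extend.extension P x x≢0) xs xs≢0

  extendAll-extends : ∀ P xs xs≢0 {z} → z ∈ domain P →
                      z ∈ domain (extendAll P xs xs≢0) × χ (extendAll P xs xs≢0) z ≋ χ P z
  extendAll-extends P []       []           z∈D = z∈D , ≋-refl
  extendAll-extends P (x ∷ xs) (x≢0 ∷ xs≢0) z∈D =
    let z∈D′ , χ′z≋χz = Extend.extension-extends P x x≢0 z∈D
        z∈D″ , χ″z≋χ′z = extendAll-extends (Extend.extension P x x≢0) xs xs≢0 z∈D′
    in z∈D″ , ≋-trans χ″z≋χ′z χ′z≋χz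

  extendAll-covers : ∀ P xs xs≢0 {z} → z ∈ xs → z ∈ domain (extendAll P xs xs≢0)
  extendAll-covers P (x ∷ xs) (x≢0 ∷ xs≢0) (here ≡.refl) =
    proj₁ (extendAll-extends (Extend.extension P x x≢0) xs xs≢0 (proj₁ (Extend.extension-y P x x≢0)))
  extendAll-covers P (x ∷ xs) (x≢0 ∷ xs≢0) (there z∈xs) = extendAll-covers (Extend.extension P x x≢0) xs xs≢0 z∈xs

  separating-character : (H : List Carrier) → (∀ {x} → x ∈ H → x ≢ 0#) → 1# ∈ H →
                         (∀ {x y} → x ∈ H → y ∈ H → x · y ∈ H) → ∀ {a} → a ≢ 0# → a ∉ H →
                         ∃[ c ] NonTrivial c × (∀ {h} → h ∈ H → IsTrivialValue c h)
  separating-character H H≢0 1∈H H-closed {a} a≢0 a∉H = character , (a , a≢0 , χa-nontrivial) , trivial-on-H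
    where
    trivial : PartialCharacter
    trivial = record
      { domain = H ; χ = λ _ → 0ℤ ; domain-nonzero = H≢0 ; 1∈domain = 1∈H
      ; domain-·-closed = H-closed ; χ-homo = λ _ _ → ≋-refl }
    open Order trivial a a≢0 using (j; Q; N≡Q*j; Q≢0; compatible-with; least-period)

    j*Q≋0 : + j * + Q ≋ 0ℤ
    j*Q≋0 = ∣⇒≋0 (divides 1ℤ (begin
      + j * + Q    ≡⟨ ℤP.pos-* j Q ⟨
      + (j ℕ.* Q)  ≡⟨ cong +_ (≡.trans (ℕP.*-comm j Q) (sym N≡Q*j)) ⟩
      + N          ≡⟨ ℤP.*-identityˡ (+ N) ⟨
      1ℤ * + N     ∎))
      where open ≡-Reasoning

    -- Extending by a with t = N / j, where j > 1 is the order of a modulo H, gives χ(a) ≢ 0.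
    open Extension trivial a a≢0 (+ Q) (compatible-with (+ Q) j*Q≋0)
      using (extension; extension-extends; extension-y)

    full : PartialCharacter
    full = extendAll extension units (All.tabulate units-nonzero)

    covers : ∀ {x} → x ≢ 0# → x ∈ domain full
    covers x≢0 = extendAll-covers extension units _ (∈-units x≢0)

    character : MultCharacter
    character = record
      { χ   = χ full
      ; hom = λ x y x≢0 y≢0 → ∣⇒∣ᵤ (_≋_.N∣a-b (PartialCharacter.χ-homo full (covers x≢0) (covers y≢0))) }

    χa≋Q : χ full a ≋ + Q
    χa≋Q = ≋-trans (proj₂ (extendAll-extends extension units _ (proj₁ extension-y))) (proj₂ extension-y)

    Q<N : Q ℕ.< N
    Q<N = subst (Q ℕ.<_) (sym N≡Q*j) (ℕP.m<m*n Q j ⦃ ℕ.≢-nonZero Q≢0 ⦄ 1<j)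
      where
      1<j : 1 ℕ.< j
      1<j with proj₁ least-period in j′≡ | proj₁ (proj₂ least-period)
      ... | zero  | a^1∈H = ⊥-elim (a∉H (subst (_∈ H) (*-identityʳ a) a^1∈H))
      ... | suc _ | _     = ℕ.s≤s (ℕ.s≤s ℕ.z≤n)

    χa-nontrivial : ¬ IsTrivialValue character a
    χa-nontrivial N∣χa =
      ℕP.<⇒≱ Q<N (∣⇒≤ ⦃ ℕ.≢-nonZero Q≢0 ⦄ (∣⇒∣ᵤ (≋0⇒∣ (≋-trans (≋-sym χa≋Q) (∣⇒≋0 (∣ᵤ⇒∣ N∣χa))))))

    trivial-on-H : ∀ {h} → h ∈ H → IsTrivialValue character h
    trivial-on-H h∈H = ∣⇒∣ᵤ (≋0⇒∣ (≋-trans (proj₂ (extendAll-extends extension units _ (proj₁ (extension-extends h∈H))))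
                                            (proj₂ (extension-extends h∈H))))

module AffineGroup (F : FiniteField) where
  open FieldFacts F
  open Affine F

  act : Aff → Carrier → Carrier
  act (a , b) x = a · x ⊞ b

  act-∘ₐ : ∀ g h x → act (g ∘ₐ h) x ≡ act g (act h x)
  act-∘ₐ (a , b) (c , d) x = solve 5 (λ a b c d x → (a :* c) :* x :+ (a :* d :+ b)
                                         := a :* (c :* x :+ d) :+ b) ≡.refl a b c d x

  act-idₐ : ∀ x → act idₐ x ≡ x
  act-idₐ x = ≡.trans (+-identityʳ _) (*-identityˡ x)

  ∘ₐ-assoc : ∀ g h k → (g ∘ₐ h) ∘ₐ k ≡ g ∘ₐ (h ∘ₐ k)
  ∘ₐ-assoc (a , b) (c , d) (e , f) = cong₂ _,_ (*-assoc a c e) (act-∘ₐ (a , b) (c , d) f)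

  ∘ₐ-identityˡ : ∀ g → idₐ ∘ₐ g ≡ g
  ∘ₐ-identityˡ (a , b) = cong₂ _,_ (*-identityˡ a) (act-idₐ b)

  ∘ₐ-identityʳ : ∀ g → g ∘ₐ idₐ ≡ g
  ∘ₐ-identityʳ (a , b) = cong₂ _,_ (*-identityʳ a) (≡.trans (cong (_⊞ b) (zeroʳ a)) (+-identityˡ b))

  ∘ₐ-isAff : ∀ g h → IsAff g → IsAff h → IsAff (g ∘ₐ h)
  ∘ₐ-isAff _ _ = ·-nonzero

  invₐ : (g : Aff) → IsAff g → Aff
  invₐ (a , b) a≢0 = inv a a≢0 , ⊟ (inv a a≢0 · b)

  invₐ-isAff : ∀ g (g-aff : IsAff g) → IsAff (invₐ g g-aff)
  invₐ-isAff (a , b) = inv-nonzero a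

  ∘ₐ-inverseʳ : ∀ g (g-aff : IsAff g) → g ∘ₐ invₐ g g-aff ≡ idₐ
  ∘ₐ-inverseʳ (a , b) a≢0 = cong₂ _,_ (·-inverseʳ a a≢0) (begin
    a · ⊟ (a⁻¹ · b) ⊞ b ≡⟨ solve 3 (λ a a⁻¹ b → a :* (:- (a⁻¹ :* b)) :+ b := b :- (a :* a⁻¹) :* b)
                                  ≡.refl a a⁻¹ b ⟩
    b ⊟ (a · a⁻¹) · b   ≡⟨ cong (λ u → b ⊟ u · b) (·-inverseʳ a a≢0) ⟩
    b ⊟ 1# · b          ≡⟨ cong (λ u → b ⊟ u) (*-identityˡ b) ⟩
    b ⊟ b               ≡⟨ -‿inverseʳ b ⟩
    0#                  ∎)
    where
    open ≡-Reasoning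
    a⁻¹ : Carrier
    a⁻¹ = inv a a≢0

  ∘ₐ-inverseˡ : ∀ g (g-aff : IsAff g) → invₐ g g-aff ∘ₐ g ≡ idₐ
  ∘ₐ-inverseˡ (a , b) a≢0 = cong₂ _,_ (·-inverseˡ a a≢0)
    (solve 2 (λ a⁻¹ b → a⁻¹ :* b :+ :- (a⁻¹ :* b) := con 0ℤ) ≡.refl (inv a a≢0) b)

  act-invₐ : ∀ g (g-aff : IsAff g) x → act g (act (invₐ g g-aff) x) ≡ x
  act-invₐ g g-aff x = ≡.trans (sym (act-∘ₐ g _ x)) (≡.trans (cong (λ h → act h x) (∘ₐ-inverseʳ g g-aff)) (act-idₐ x))

  invₐ-act : ∀ g (g-aff : IsAff g) x → act (invₐ g g-aff) (act g x) ≡ x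
  invₐ-act g g-aff x = ≡.trans (sym (act-∘ₐ _ g x)) (≡.trans (cong (λ h → act h x) (∘ₐ-inverseˡ g g-aff)) (act-idₐ x))

  conjugate-translation : ∀ g h v → g ∘ₐ h ≡ idₐ → g ∘ₐ ((1# , v) ∘ₐ h) ≡ (1# , proj₁ g · v)
  conjugate-translation (a , b) (c , d) v g∘h≡id = cong₂ _,_ (≡.trans (cong (a ·_) (*-identityˡ c)) (cong proj₁ g∘h≡id)) (begin
    a · (1# · d ⊞ v) ⊞ b   ≡⟨ cong (λ u → a · (u ⊞ v) ⊞ b) (*-identityˡ d) ⟩
    a · (d ⊞ v) ⊞ b        ≡⟨ solve 4 (λ a d v b → a :* (d :+ v) :+ b := (a :* d :+ b) :+ a :* v) ≡.refl a d v b ⟩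
    (a · d ⊞ b) ⊞ a · v    ≡⟨ cong (_⊞ a · v) (cong proj₂ g∘h≡id) ⟩
    0# ⊞ a · v             ≡⟨ +-identityˡ _ ⟩
    a · v                  ∎)
    where open ≡-Reasoning

  fixed-point : ∀ a b → a ≢ 1# → ∃[ p ] act (a , b) p ≡ p
  fixed-point a b a≢1 = p , (begin
    a · p ⊞ b              ≡⟨ cong (a · p ⊞_) p·[1-a]≡b ⟨
    a · p ⊞ p · (1# ⊟ a)   ≡⟨ solve 3 (λ a p o → a :* p :+ p :* (o :- a) := p :* o) ≡.refl a p 1# ⟩
    p · 1#                 ≡⟨ *-identityʳ p ⟩
    p                      ∎)
    where
    open ≡-Reasoning
    1-a≢0 : 1# ⊟ a ≢ 0#
    1-a≢0 = a≢1 ∘ sym ∘ ⊟≡0⇒≡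
    p = b · inv (1# ⊟ a) 1-a≢0
    p·[1-a]≡b : p · (1# ⊟ a) ≡ b
    p·[1-a]≡b = ≡.trans (*-assoc b _ _) (≡.trans (cong (b ·_) (·-inverseˡ _ 1-a≢0)) (*-identityʳ b))

  fixed-point-unique : ∀ γ → proj₁ γ ≢ 1# → ∀ {x y} → act γ x ≡ x → act γ y ≡ y → x ≡ y
  fixed-point-unique (a , b) a≢1 {x} {y} γx≡x γy≡y =
    ⊟≡0⇒≡ (·-cancelˡ (a≢1 ∘ sym ∘ ⊟≡0⇒≡) (begin
      (1# ⊟ a) · (x ⊟ y)
        ≡⟨ solve 5 (λ o a x y b → (o :- a) :* (x :- y)
                       := (a :* y :+ b :- y :* o) :- (a :* x :+ b :- x :* o)) ≡.refl 1# a x y b ⟩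
      (a · y ⊞ b ⊟ y · 1#) ⊟ (a · x ⊞ b ⊟ x · 1#)
        ≡⟨ cong₂ (λ u v → (a · y ⊞ b ⊟ u) ⊟ (a · x ⊞ b ⊟ v)) (*-identityʳ y) (*-identityʳ x) ⟩
      (a · y ⊞ b ⊟ y) ⊟ (a · x ⊞ b ⊟ x)
        ≡⟨ cong₂ (λ u v → (u ⊟ y) ⊟ (v ⊟ x)) γy≡y γx≡x ⟩
      (y ⊟ y) ⊟ (x ⊟ x)
        ≡⟨ solve 2 (λ x y → (y :- y) :- (x :- x) := con 0ℤ) ≡.refl x y ⟩
      0#
        ≡⟨ zeroʳ _ ⟨
      (1# ⊟ a) · 0#                            ∎))
    where open ≡-Reasoning

  commuting-preserves-fixed : ∀ γ g → γ ∘ₐ g ≡ g ∘ₐ γ → ∀ {x} → act γ x ≡ x → act γ (act g x) ≡ act g x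
  commuting-preserves-fixed γ g γg≡gγ {x} γx≡x = begin
    act γ (act g x)  ≡⟨ act-∘ₐ γ g x ⟨
    act (γ ∘ₐ g) x   ≡⟨ cong (λ h → act h x) γg≡gγ ⟩
    act (g ∘ₐ γ) x   ≡⟨ act-∘ₐ g γ x ⟩
    act g (act γ x)  ≡⟨ cong (act g) γx≡x ⟩
    act g x          ∎
    where open ≡-Reasoning

  prodₐ-isAff : ∀ {n} (v : Vec Aff n) → VAll.All IsAff v → IsAff (prodₐ (toList v))
  prodₐ-isAff Vec.[]       VAll.[]             = 1≢0
  prodₐ-isAff (g Vec.∷ v) (g-aff VAll.∷ v-aff) = ∘ₐ-isAff g (prodₐ (toList v)) g-aff (prodₐ-isAff v v-aff)

  meetsLeftCoset : ∀ {n A Γ z} (z-aff : IsAff z) (v : Vec Aff n) → VAll.All (_∈ AffSubset.elems A) v →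
                   invₐ z z-aff ∘ₐ prodₐ (toList v) ∈ AffSubset.elems Γ → MeetsLeftCoset n A z Γ
  meetsLeftCoset {z = z} z-aff v v∈A γ∈Γ = v , v∈A , _ , γ∈Γ , (begin
    w                                 ≡⟨ ∘ₐ-identityˡ w ⟨
    idₐ ∘ₐ w                          ≡⟨ cong (_∘ₐ w) (∘ₐ-inverseʳ z z-aff) ⟨
    (z ∘ₐ invₐ z z-aff) ∘ₐ w          ≡⟨ ∘ₐ-assoc z _ w ⟩
    z ∘ₐ (invₐ z z-aff ∘ₐ w)          ∎)
    where
    open ≡-Reasoning
    w : Aff
    w = prodₐ (toList v)

  meetsRightCoset : ∀ {n A Γ z} (z-aff : IsAff z) (v : Vec Aff n) → VAll.All (_∈ AffSubset.elems A) v →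
                    prodₐ (toList v) ∘ₐ invₐ z z-aff ∈ AffSubset.elems Γ → MeetsRightCoset n A z Γ
  meetsRightCoset {z = z} z-aff v v∈A γ∈Γ = v , v∈A , _ , γ∈Γ , (begin
    w                                 ≡⟨ ∘ₐ-identityʳ w ⟨
    w ∘ₐ idₐ                          ≡⟨ cong (w ∘ₐ_) (∘ₐ-inverseˡ z z-aff) ⟨
    w ∘ₐ (invₐ z z-aff ∘ₐ z)          ≡⟨ ∘ₐ-assoc w _ z ⟨
    (w ∘ₐ invₐ z z-aff) ∘ₐ z          ∎)
    where
    open ≡-Reasoning
    w : Aff
    w = prodₐ (toList v)

  module _ {n : ℕ} (A Γ : AffSubset) {z : Aff} (z-aff : IsAff z) where
    private
      Aℓ Γℓ : List Aff
      Aℓ = AffSubset.elems A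
      Γℓ = AffSubset.elems Γ

    meetsCosets-if-full : (∀ g → IsAff g → g ∈ Γℓ) → (v : Vec Aff n) → VAll.All (_∈ Aℓ) v →
                          MeetsLeftCoset n A z Γ × MeetsRightCoset n A z Γ
    meetsCosets-if-full Γ-full v v∈A =
      meetsLeftCoset {A = A} {Γ = Γ} z-aff v v∈A
        (Γ-full (invₐ z z-aff ∘ₐ w) (∘ₐ-isAff (invₐ z z-aff) w (invₐ-isAff z z-aff) w-aff)) ,
      meetsRightCoset {A = A} {Γ = Γ} z-aff v v∈A
        (Γ-full (w ∘ₐ invₐ z z-aff) (∘ₐ-isAff w (invₐ z z-aff) w-aff (invₐ-isAff z z-aff)))
      where
      w : Aff
      w = prodₐ (toList v)
      w-aff : IsAff w
      w-aff = prodₐ-isAff v (VAll.map (AffSubset.valid A) v∈A)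

    meetsCosets-if-stabiliser : ∀ p → (∀ g → IsAff g → act g p ≡ p → g ∈ Γℓ) →
                                (∀ x y → ∃[ v ] VAll.All (_∈ Aℓ) v × act (prodₐ (toList {n = n} v)) x ≡ y) →
                                MeetsLeftCoset n A z Γ × MeetsRightCoset n A z Γ
    meetsCosets-if-stabiliser p stab⊆Γ transitive = left , right
      where
      z⁻¹ : Aff
      z⁻¹ = invₐ z z-aff
      left : MeetsLeftCoset n A z Γ
      left with transitive p (act z p)
      ... | v , v∈A , wp≡zp = meetsLeftCoset {A = A} {Γ = Γ} z-aff v v∈A
        (stab⊆Γ (z⁻¹ ∘ₐ w) (∘ₐ-isAff z⁻¹ w (invₐ-isAff z z-aff) w-aff) (begin
        act (z⁻¹ ∘ₐ w) p      ≡⟨ act-∘ₐ z⁻¹ w p ⟩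
        act z⁻¹ (act w p)     ≡⟨ cong (act z⁻¹) wp≡zp ⟩
        act z⁻¹ (act z p)     ≡⟨ invₐ-act z z-aff p ⟩
        p                     ∎))
        where
        open ≡-Reasoning
        w : Aff
        w = prodₐ (toList v)
        w-aff = prodₐ-isAff v (VAll.map (AffSubset.valid A) v∈A)
      right : MeetsRightCoset n A z Γ
      right with transitive (act z⁻¹ p) p
      ... | v , v∈A , wz⁻¹p≡p = meetsRightCoset {A = A} {Γ = Γ} z-aff v v∈A
        (stab⊆Γ (w ∘ₐ z⁻¹) (∘ₐ-isAff w z⁻¹ w-aff (invₐ-isAff z z-aff))
        (≡.trans (act-∘ₐ w z⁻¹ p) wz⁻¹p≡p))
        where
        w : Aff
        w = prodₐ (toList v)
        w-aff = prodₐ-isAff v (VAll.map (AffSubset.valid A) v∈A)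

module Averaging (F : FiniteField) where
  open FieldFacts F
  open Affine F using (Aff; IsAff; prodₐ; AffSubset)
  open AffineGroup F
  open IntegerSum
  open IntegerSum.WithDecidableEquality _≟_ using (δ; δ-cases; δ-≢; δ-idem; Σ-δ; Σ-δ-quadratic; term≤Σ)
  open import Data.Integer using (_+_; _*_; -_; _-_; _≤_)
  open import Data.Integer.Solver using (module +-*-Solver)
  import Data.Nat.Solver
  open import Data.List.Membership.Propositional using (find; lose)
  open import Data.List.Relation.Unary.Any using (Any; any?)
  module Z = +-*-Solver
  module NS = Data.Nat.Solver.+-*-Solver

  q : ℕ
  q = order

  ‖_‖² : (Carrier → ℤ) → ℤ
  ‖ f ‖² = Σ elements (λ x → f x * f x)

  ‖‖²-nonneg : ∀ f → 0ℤ ≤ ‖ f ‖²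
  ‖‖²-nonneg f = Σ-nonneg elements _ (λ {x} _ → square-nonneg (f x))

  Σ-act : ∀ g → IsAff g → (f : Carrier → ℤ) → Σ elements (f ∘ act g) ≡ Σ elements f
  Σ-act g g-aff = Σ-bijection (act g) (act (invₐ g g-aff)) elements-unique
                    (λ _ → elements-complete _) (λ _ → elements-complete _) (invₐ-act g g-aff) (act-invₐ g g-aff)

  Σ-translate : ∀ c (f : Carrier → ℤ) → Σ elements (λ u → f (c ⊞ u)) ≡ Σ elements f
  Σ-translate c f = ≡.trans (Σ-cong elements (λ {u} _ → cong f (≡.trans (+-comm c u) (cong (_⊞ c) (sym (*-identityˡ u))))))
                            (Σ-act (1# , c) 1≢0 f)

  Σ-units-scale : ∀ d → d ≢ 0# → (f : Carrier → ℤ) → Σ units (λ a → f (a · d)) ≡ Σ units f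
  Σ-units-scale d d≢0 = Σ-bijection (_· d) (_· inv d d≢0) units-unique
    (λ a∈ → ∈-units (·-nonzero (units-nonzero a∈) d≢0))
    (λ a∈ → ∈-units (·-nonzero (units-nonzero a∈) (inv-nonzero d d≢0)))
    (λ a → ≡.trans (*-assoc a d _) (≡.trans (cong (a ·_) (·-inverseʳ d d≢0)) (*-identityʳ a)))
    (λ a → ≡.trans (*-assoc a _ d) (≡.trans (cong (a ·_) (·-inverseˡ d d≢0)) (*-identityʳ a)))

  group : List Aff
  group = cartesianProduct units elements

  Σ-group : ∀ (φ : Aff → ℤ) → Σ group φ ≡ Σ units (λ a → Σ elements (λ b → φ (a , b)))
  Σ-group = Σ-cartesianProduct units elements

  module Correlation (f : Carrier → ℤ) (f-mean0 : Σ elements f ≡ 0ℤ) where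

    R : Carrier → ℤ
    R d = Σ elements (λ u → f u * f (u ⊞ d))

    R-0 : R 0# ≡ ‖ f ‖²
    R-0 = Σ-cong elements (λ {u} _ → cong (λ v → f u * f v) (+-identityʳ u))

    Σ-R : Σ elements R ≡ 0ℤ
    Σ-R = begin
      Σ elements (λ d → Σ elements (λ u → f u * f (u ⊞ d)))
        ≡⟨ Σ-comm elements elements _ ⟩
      Σ elements (λ u → Σ elements (λ d → f u * f (u ⊞ d)))
        ≡⟨ Σ-cong elements (λ {u} _ → Σ-*ˡ elements (f u) _) ⟩
      Σ elements (λ u → f u * Σ elements (λ d → f (u ⊞ d)))
        ≡⟨ Σ-cong elements (λ {u} _ → cong (f u *_) (≡.trans (Σ-translate u f) f-mean0)) ⟩
      Σ elements (λ u → f u * 0ℤ)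
        ≡⟨ ≡.trans (Σ-cong elements (λ {u} _ → ℤP.*-zeroʳ (f u))) (Σ-0 elements) ⟩
      0ℤ                                                   ∎
      where open ≡-Reasoning

    Σ-units-R : ∀ x y → Σ units (λ a → R (a · (y ⊟ x))) ≡ + q * ‖ f ‖² * δ y x - ‖ f ‖²
    Σ-units-R x y with δ-cases y x
    ... | inj₁ (≡.refl , δyy≡1) = begin
      Σ units (λ a → R (a · (y ⊟ y)))
        ≡⟨ Σ-cong units (λ {a} _ → ≡.trans (cong (λ d → R (a · d)) (-‿inverseʳ y)) (≡.trans (cong R (zeroʳ a)) R-0)) ⟩
      Σ units (λ _ → ‖ f ‖²)
        ≡⟨ Σ-const units ‖ f ‖² ⟩
      + length units * ‖ f ‖²
        ≡⟨ cong (λ n → + n * ‖ f ‖²) N≡|units| ⟨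
      + N * ‖ f ‖²
        ≡⟨ Z.solve 2 (λ n s → n Z.:* s Z.:= (Z.con 1ℤ Z.:+ n) Z.:* s Z.:* Z.con 1ℤ Z.:- s) ≡.refl (+ N) ‖ f ‖² ⟩
      + suc N * ‖ f ‖² * 1ℤ - ‖ f ‖²
        ≡⟨ cong₂ (λ n e → + n * ‖ f ‖² * e - ‖ f ‖²) order≡1+N δyy≡1 ⟨
      + q * ‖ f ‖² * δ y y - ‖ f ‖²     ∎
      where open ≡-Reasoning
    ... | inj₂ (y≢x , δyx≡0) = begin
      Σ units (λ a → R (a · (y ⊟ x)))
        ≡⟨ Σ-units-scale (y ⊟ x) (y≢x ∘ ⊟≡0⇒≡) R ⟩
      Σ units R
        ≡⟨ Z.solve 2 (λ s r → s Z.:= (r Z.:+ s) Z.:- r) ≡.refl (Σ units R) (R 0#) ⟩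
      (R 0# + Σ units R) - R 0#
        ≡⟨ cong₂ _-_ (≡.trans (sym (Σ-remove _≟_ R elements-unique (elements-complete 0#))) Σ-R) R-0 ⟩
      0ℤ - ‖ f ‖²
        ≡⟨ cong (λ e → e - ‖ f ‖²) (≡.trans (sym (ℤP.*-zeroʳ (+ q * ‖ f ‖²))) (cong (+ q * ‖ f ‖² *_) (sym δyx≡0))) ⟩
      + q * ‖ f ‖² * δ y x - ‖ f ‖²     ∎
      where open ≡-Reasoning

    Σ-group-correlation : ∀ x y → Σ group (λ g → f (act g x) * f (act g y)) ≡ + q * ‖ f ‖² * δ y x - ‖ f ‖²
    Σ-group-correlation x y = begin
      Σ group (λ g → f (act g x) * f (act g y))                           ≡⟨ Σ-group _ ⟩
      Σ units (λ a → Σ elements (λ b → f (a · x ⊞ b) * f (a · y ⊞ b)))    ≡⟨ Σ-cong units (λ {a} _ → Σ-over-b a) ⟩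
      Σ units (λ a → R (a · (y ⊟ x)))                                     ≡⟨ Σ-units-R x y ⟩
      + q * ‖ f ‖² * δ y x - ‖ f ‖²                                       ∎
      where
      open ≡-Reasoning
      Σ-over-b : ∀ a → Σ elements (λ b → f (a · x ⊞ b) * f (a · y ⊞ b)) ≡ R (a · (y ⊟ x))
      Σ-over-b a = ≡.trans
        (Σ-cong elements (λ {b} _ → cong (λ v → f (a · x ⊞ b) * f v)
          (solve 4 (λ a x y b → a :* y :+ b := (a :* x :+ b) :+ a :* (y :- x)) ≡.refl a x y b)))
        (Σ-translate (a · x) (λ u → f u * f (u ⊞ a · (y ⊟ x))))

    X : (Carrier → ℤ) → Aff → ℤ
    X h g = Σ elements (λ x → f (act g x) * h x)

    Σ-group-X² : ∀ h → Σ group (λ g → X h g * X h g) ≡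
                       + q * ‖ f ‖² * ‖ h ‖² - ‖ f ‖² * (Σ elements h * Σ elements h)
    Σ-group-X² h = begin
      Σ group (λ g → X h g * X h g)
        ≡⟨ Σ-cong group (λ {g} _ → Σ-* elements elements _ _) ⟩
      Σ group (λ g → Σ elements (λ x → Σ elements (λ y → (f (act g x) * h x) * (f (act g y) * h y))))
        ≡⟨ Σ-comm group elements _ ⟩
      Σ elements (λ x → Σ group (λ g → Σ elements (λ y → (f (act g x) * h x) * (f (act g y) * h y))))
        ≡⟨ Σ-cong elements (λ {x} _ → Σ-comm group elements _) ⟩
      Σ elements (λ x → Σ elements (λ y → Σ group (λ g → (f (act g x) * h x) * (f (act g y) * h y))))
        ≡⟨ Σ-cong elements (λ {x} _ → Σ-cong elements (λ {y} _ → factor x y)) ⟩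
      Σ elements (λ x → Σ elements (λ y → (h x * h y) * (+ q * ‖ f ‖² * δ y x - ‖ f ‖²)))
        ≡⟨ Σ-δ-quadratic h (+ q * ‖ f ‖²) ‖ f ‖² elements-unique ⟩
      + q * ‖ f ‖² * ‖ h ‖² - ‖ f ‖² * (Σ elements h * Σ elements h) ∎
      where
      open ≡-Reasoning
      factor : ∀ x y → Σ group (λ g → (f (act g x) * h x) * (f (act g y) * h y)) ≡
                       (h x * h y) * (+ q * ‖ f ‖² * δ y x - ‖ f ‖²)
      factor x y = begin
        Σ group (λ g → (f (act g x) * h x) * (f (act g y) * h y))
          ≡⟨ Σ-cong group (λ {g} _ → Z.solve 4 (λ a b c d → (a Z.:* b) Z.:* (c Z.:* d)
                                                   Z.:= (b Z.:* d) Z.:* (a Z.:* c))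
                                               ≡.refl (f (act g x)) (h x) (f (act g y)) (h y)) ⟩
        Σ group (λ g → (h x * h y) * (f (act g x) * f (act g y)))
          ≡⟨ Σ-*ˡ group (h x * h y) _ ⟩
        (h x * h y) * Σ group (λ g → f (act g x) * f (act g y))
          ≡⟨ cong ((h x * h y) *_) (Σ-group-correlation x y) ⟩
        (h x * h y) * (+ q * ‖ f ‖² * δ y x - ‖ f ‖²) ∎

  module Probe (r : Carrier) where

    probe : Carrier → ℤ
    probe x = + q * δ x r - 1ℤ

    probe-off : ∀ y → y ≢ r → probe y ≡ ℤ.-1ℤ
    probe-off y y≢r = ≡.trans (cong (λ e → + q * e - 1ℤ) (δ-≢ y≢r)) (cong (_- 1ℤ) (ℤP.*-zeroʳ (+ q)))

    probe-mean0 : Σ elements probe ≡ 0ℤ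
    probe-mean0 = begin
      Σ elements probe
        ≡⟨ Σ-difference elements _ _ ⟩
      Σ elements (λ x → + q * δ x r) - Σ elements (λ _ → 1ℤ)
        ≡⟨ cong₂ _-_ (Σ-δ (λ _ → + q) elements-unique (elements-complete r)) (Σ-const elements 1ℤ) ⟩
      + q - + q * 1ℤ
        ≡⟨ Z.solve 1 (λ q → q Z.:- q Z.:* Z.con 1ℤ Z.:= Z.con 0ℤ) ≡.refl (+ q) ⟩
      0ℤ                                                             ∎
      where open ≡-Reasoning

    ‖probe‖² : ‖ probe ‖² ≡ + q * + q - + q
    ‖probe‖² = begin
      Σ elements (λ x → probe x * probe x)                             ≡⟨ Σ-cong elements (λ {x} _ → square x) ⟩
      Σ elements (λ x → (+ q * + q - + 2 * + q) * δ x r + 1ℤ)          ≡⟨ Σ-+ elements _ _ ⟩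
      Σ elements (λ x → (+ q * + q - + 2 * + q) * δ x r) + Σ elements (λ _ → 1ℤ)
        ≡⟨ cong₂ _+_ (Σ-δ (λ _ → + q * + q - + 2 * + q) elements-unique (elements-complete r)) (Σ-const elements 1ℤ) ⟩
      (+ q * + q - + 2 * + q) + + q * 1ℤ
        ≡⟨ Z.solve 1 (λ q → (q Z.:* q Z.:- Z.con (+ 2) Z.:* q) Z.:+ q Z.:* Z.con 1ℤ Z.:= q Z.:* q Z.:- q) ≡.refl (+ q) ⟩
      + q * + q - + q                                                  ∎
      where
      open ≡-Reasoning
      square : ∀ x → probe x * probe x ≡ (+ q * + q - + 2 * + q) * δ x r + 1ℤ
      square x = begin
        (+ q * e - 1ℤ) * (+ q * e - 1ℤ)
          ≡⟨ Z.solve 2 (λ q e → (q Z.:* e Z.:- Z.con 1ℤ) Z.:* (q Z.:* e Z.:- Z.con 1ℤ)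
                           Z.:= q Z.:* q Z.:* (e Z.:* e) Z.:- Z.con (+ 2) Z.:* q Z.:* e Z.:+ Z.con 1ℤ) ≡.refl (+ q) e ⟩
        + q * + q * (e * e) - + 2 * + q * e + 1ℤ
          ≡⟨ cong (λ e² → + q * + q * e² - + 2 * + q * e + 1ℤ) (δ-idem x r) ⟩
        + q * + q * e - + 2 * + q * e + 1ℤ
          ≡⟨ Z.solve 2 (λ q e → q Z.:* q Z.:* e Z.:- Z.con (+ 2) Z.:* q Z.:* e Z.:+ Z.con 1ℤ
                           Z.:= (q Z.:* q Z.:- Z.con (+ 2) Z.:* q) Z.:* e Z.:+ Z.con 1ℤ) ≡.refl (+ q) e ⟩
        (+ q * + q - + 2 * + q) * e + 1ℤ                ∎
        where e = δ x r

  module Operator (A : AffSubset) where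
    open AffSubset A renaming (elems to A-list; unique to A-unique; valid to A-valid)
    open IntegerSum.WithDecidableEquality (×.≡-dec _≟_ _≟_) using (Σ-mono-⊆)

    T : (Carrier → ℤ) → Carrier → ℤ
    T f x = Σ A-list (λ g → f (act g x))

    T-mean0 : ∀ f → Σ elements f ≡ 0ℤ → Σ elements (T f) ≡ 0ℤ
    T-mean0 f f-mean0 = ≡.trans (Σ-comm elements A-list _)
      (≡.trans (Σ-cong A-list (λ g∈A → ≡.trans (Σ-act _ (A-valid g∈A) f) f-mean0)) (Σ-0 A-list))

    A⊆group : ∀ {g} → g ∈ A-list → g ∈ group
    A⊆group {_ , b} g∈A = ∈.∈-cartesianProduct⁺ (∈-units (A-valid g∈A)) (elements-complete b)

    -- Cauchy–Schwarz over A, then enlarge A to the whole group, where Σ-group-X² is exact.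
    T-norm : ∀ f → Σ elements f ≡ 0ℤ → ‖ T f ‖² ≤ + q * + size * ‖ f ‖²
    T-norm f f-mean0 = square-cancel (‖‖²-nonneg h) bound-nonneg (begin
      S * S                                      ≡⟨ cong₂ _*_ S≡ΣX S≡ΣX ⟩
      Σ A-list (X h) * Σ A-list (X h)            ≤⟨ cauchy-schwarz A-list (X h) ⟩
      + size * Σ A-list (λ g → X h g * X h g)    ≤⟨ ℤP.*-monoˡ-≤-nonNeg (+ size) A-to-group ⟩
      + size * Σ group (λ g → X h g * X h g)     ≡⟨ cong (+ size *_) (Σ-group-X² h) ⟩
      + size * (+ q * ‖ f ‖² * S - ‖ f ‖² * (Σ elements h * Σ elements h))
        ≤⟨ ℤP.*-monoˡ-≤-nonNeg (+ size) (ℤP.i-j≤i _ _ ⦃ ℤ.nonNegative (*-nonneg (‖‖²-nonneg f) (square-nonneg (Σ elements h))) ⦄) ⟩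
      + size * (+ q * ‖ f ‖² * S)
        ≡⟨ Z.solve 4 (λ n q s t → n Z.:* (q Z.:* s Z.:* t) Z.:= q Z.:* n Z.:* s Z.:* t) ≡.refl (+ size) (+ q) ‖ f ‖² S ⟩
      + q * + size * ‖ f ‖² * S                  ∎)
      where
      open Correlation f f-mean0 using (X; Σ-group-X²)
      open ℤP.≤-Reasoning
      h : Carrier → ℤ
      h = T f
      S : ℤ
      S = ‖ h ‖²
      bound-nonneg : 0ℤ ≤ + q * + size * ‖ f ‖²
      bound-nonneg = *-nonneg (*-nonneg {+ q} {+ size} (+≤+ ℕ.z≤n) (+≤+ ℕ.z≤n)) (‖‖²-nonneg f)
      S≡ΣX : S ≡ Σ A-list (X h)
      S≡ΣX = ≡.trans (Σ-cong elements (λ {x} _ → sym (Σ-*ʳ A-list (λ g → f (act g x)) (h x))))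
                     (Σ-comm elements A-list _)
      A-to-group : Σ A-list (λ g → X h g * X h g) ≤ Σ group (λ g → X h g * X h g)
      A-to-group = Σ-mono-⊆ _ A-unique (Unique.cartesianProduct⁺ units-unique elements-unique) A⊆group
                     (λ {g} _ → square-nonneg (X h g))

    Tⁿ : ℕ → (Carrier → ℤ) → Carrier → ℤ
    Tⁿ zero    f = f
    Tⁿ (suc n) f = Tⁿ n (T f)

    Tⁿ-norm : ∀ n f → Σ elements f ≡ 0ℤ → ‖ Tⁿ n f ‖² ≤ + (q ℕ.^ n ℕ.* size ℕ.^ n) * ‖ f ‖²
    Tⁿ-norm zero    f _       = ℤP.≤-reflexive (sym (ℤP.*-identityˡ ‖ f ‖²))
    Tⁿ-norm (suc n) f f-mean0 = begin
      ‖ Tⁿ n (T f) ‖²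
        ≤⟨ Tⁿ-norm n (T f) (T-mean0 f f-mean0) ⟩
      + K * ‖ T f ‖²
        ≤⟨ ℤP.*-monoˡ-≤-nonNeg (+ K) (T-norm f f-mean0) ⟩
      + K * (+ q * + size * ‖ f ‖²)
        ≡⟨ Z.solve 4 (λ k a b s → k Z.:* (a Z.:* b Z.:* s)
                         Z.:= (a Z.:* b Z.:* k) Z.:* s) ≡.refl (+ K) (+ q) (+ size) ‖ f ‖² ⟩
      (+ q * + size * + K) * ‖ f ‖²
        ≡⟨ cong (_* ‖ f ‖²) (≡.trans (ℤP.pos-* (q ℕ.* size) K) (cong (_* + K) (ℤP.pos-* q size))) ⟨
      + (q ℕ.* size ℕ.* K) * ‖ f ‖²
        ≡⟨ cong (λ m → + m * ‖ f ‖²) (NS.solve 4 (λ q s a b → q NS.:* s NS.:* (a NS.:* b)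
                                                     NS.:= (q NS.:* a) NS.:* (s NS.:* b))
                                                 ≡.refl q size (q ℕ.^ n) (size ℕ.^ n)) ⟩
      + (q ℕ.^ suc n ℕ.* size ℕ.^ suc n) * ‖ f ‖² ∎
      where
      open ℤP.≤-Reasoning
      K : ℕ
      K = q ℕ.^ n ℕ.* size ℕ.^ n

    Tⁿ-dichotomy : ∀ n (P : Carrier → Set) → Decidable P → (f : Carrier → ℤ) (c : ℤ) → (∀ y → ¬ P y → f y ≡ c) →
                   ∀ x → (∃[ v ] VAll.All (_∈ A-list) v × P (act (prodₐ (toList {n = n} v)) x)) ⊎
                         Tⁿ n f x ≡ + (size ℕ.^ n) * c
    Tⁿ-dichotomy zero P P? f c f≡c x with P? x
    ... | yes Px = inj₁ (Vec.[] , VAll.[] , subst P (sym (act-idₐ x)) Px)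
    ... | no ¬Px = inj₂ (≡.trans (f≡c x ¬Px) (sym (ℤP.*-identityˡ c)))
    Tⁿ-dichotomy (suc n) P P? f c f≡c x with Tⁿ-dichotomy n P′ P′? (T f) (+ size * c) Tf≡ x
      where
      P′ : Carrier → Set
      P′ y = Any (λ g → P (act g y)) A-list
      P′? : Decidable P′
      P′? y = any? (λ g → P? (act g y)) A-list
      Tf≡ : ∀ y → ¬ P′ y → T f y ≡ + size * c
      Tf≡ y ¬P′y = ≡.trans (Σ-cong A-list (λ {g} g∈A → f≡c (act g y) (¬P′y ∘ lose g∈A))) (Σ-const A-list c)
    ... | inj₁ (v , v∈A , P′w) = let g , g∈A , Pgw = find P′w in
      inj₁ (g Vec.∷ v , g∈A VAll.∷ v∈A , subst P (sym (act-∘ₐ g (prodₐ (toList v)) x)) Pgw)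
    ... | inj₂ Tⁿ⁺¹f≡ = inj₂ (≡.trans Tⁿ⁺¹f≡ (≡.trans (sym (ℤP.*-assoc (+ (size ℕ.^ n)) (+ size) c))
                         (cong (_* c) (≡.trans (ℤP.*-comm (+ (size ℕ.^ n)) (+ size)) (sym (ℤP.pos-* size (size ℕ.^ n)))))))

    -- If no word maps p to r then Tⁿ probe p = -|A|ⁿ, which the norm bound forbids.
    transitive : ∀ n → q ℕ.^ (n ℕ.+ 2) ℕ.< size ℕ.^ n → ∀ p r →
                 ∃[ v ] VAll.All (_∈ A-list) v × act (prodₐ (toList {n = n} v)) p ≡ r
    transitive n q^[n+2]<M p r with Tⁿ-dichotomy n (_≡ r) (_≟ r) (Probe.probe r) ℤ.-1ℤ (Probe.probe-off r) p
    ... | inj₁ found      = found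
    ... | inj₂ Tⁿprobe[p] =
      ⊥-elim (ℕP.<⇒≱ (ℕP.*-monoˡ-< M ⦃ ℕ.>-nonZero (ℕP.≤-<-trans ℕ.z≤n q^[n+2]<M) ⦄ q^[n+2]<M) M*M≤)
      where
      open Probe r
      M K : ℕ
      M = size ℕ.^ n
      K = q ℕ.^ n ℕ.* M
      K*q*q≡ : K ℕ.* (q ℕ.* q) ≡ q ℕ.^ (n ℕ.+ 2) ℕ.* M
      K*q*q≡ = ≡.trans (NS.solve 3 (λ a m b → (a NS.:* m) NS.:* (b NS.:* b)
                                       NS.:= (a NS.:* (b NS.:* (b NS.:* NS.con 1))) NS.:* m) ≡.refl (q ℕ.^ n) M q)
                       (cong (ℕ._* M) (sym (ℕP.^-distribˡ-+-* q n 2)))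
      M*M≤ : M ℕ.* M ℕ.≤ q ℕ.^ (n ℕ.+ 2) ℕ.* M
      M*M≤ = subst (M ℕ.* M ℕ.≤_) K*q*q≡ (ℤP.drop‿+≤+ (begin
        + (M ℕ.* M)
          ≡⟨ ℤP.pos-* M M ⟩
        + M * + M
          ≡⟨ Z.solve 1 (λ m → m Z.:* m Z.:= (m Z.:* Z.con ℤ.-1ℤ) Z.:* (m Z.:* Z.con ℤ.-1ℤ)) ≡.refl (+ M) ⟩
        (+ M * ℤ.-1ℤ) * (+ M * ℤ.-1ℤ)
          ≡⟨ cong₂ _*_ Tⁿprobe[p] Tⁿprobe[p] ⟨
        Tⁿ n probe p * Tⁿ n probe p
          ≤⟨ term≤Σ (λ x → Tⁿ n probe x * Tⁿ n probe x) elements-unique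
                    (λ {x} _ → square-nonneg (Tⁿ n probe x)) (elements-complete p) ⟩
        ‖ Tⁿ n probe ‖²
          ≤⟨ Tⁿ-norm n probe probe-mean0 ⟩
        + K * ‖ probe ‖²
          ≡⟨ cong (+ K *_) ‖probe‖² ⟩
        + K * (+ q * + q - + q)
          ≤⟨ ℤP.*-monoˡ-≤-nonNeg (+ K) (ℤP.i-j≤i (+ q * + q) (+ q)) ⟩
        + K * (+ q * + q)
          ≡⟨ ≡.trans (ℤP.pos-* K (q ℕ.* q)) (cong (+ K *_) (ℤP.pos-* q q)) ⟨
        + (K ℕ.* (q ℕ.* q))                  ∎))
        where open ℤP.≤-Reasoning

DetectsCharacters : (F : FiniteField) → Affine.AffSubset F → Set
DetectsCharacters F Γ = ∀ (c : MultCharacter) → NonTrivial c → ∃ λ γ → γ ∈ AffSubset.elems Γ × CharNonTrivialOn c γ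
  where open Affine F

module SubgroupStructure (F : FiniteField) (Γ : Affine.AffSubset F) (Γ-subgroup : Affine.IsSubgroup F Γ)
                         (separated : DetectsCharacters F Γ) where
  open Affine F
  open FieldFacts F
  open AffineGroup F
  open Characters F using (separating-character)
  open AffSubset Γ using () renaming (elems to Γℓ; unique to Γ-unique; valid to Γ-valid)
  open IsSubgroup Γ-subgroup
  open IntegerSum.WithDecidableEquality (×.≡-dec _≟_ _≟_) using (length-mono-⊆)
  open import Data.List.Membership.Propositional using (find; lose)
  open import Data.List.Relation.Unary.Any using (any?)
  open import Data.List.Properties using (length-map)

  linear-parts : List Carrier
  linear-parts = map proj₁ Γℓ

  linear-parts-nonzero : ∀ {x} → x ∈ linear-parts → x ≢ 0#
  linear-parts-nonzero x∈ with ∈.∈-map⁻ proj₁ x∈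
  ... | _ , g∈Γ , ≡.refl = Γ-valid g∈Γ

  linear-parts-closed : ∀ {x y} → x ∈ linear-parts → y ∈ linear-parts → x · y ∈ linear-parts
  linear-parts-closed x∈ y∈ with ∈.∈-map⁻ proj₁ x∈ | ∈.∈-map⁻ proj₁ y∈
  ... | _ , g∈Γ , ≡.refl | _ , h∈Γ , ≡.refl = ∈.∈-map⁺ proj₁ (closed g∈Γ h∈Γ)

  linear-parts-surjective : ∀ a → a ≢ 0# → ∃[ b ] (a , b) ∈ Γℓ
  linear-parts-surjective a a≢0 with any? (λ g → proj₁ g ≟ a) Γℓ
  ... | yes found = let (_ , b) , g∈Γ , g₁≡a = find found in b , subst (λ x → (x , b) ∈ Γℓ) g₁≡a g∈Γ
  ... | no  none  =
    let c , c-nontrivial , trivial-on-linear-parts =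
          separating-character linear-parts linear-parts-nonzero (∈.∈-map⁺ proj₁ has-id) linear-parts-closed a≢0 a∉
        (_ , _) , γ∈Γ , χγ≠1 = separated c c-nontrivial
    in ⊥-elim (χγ≠1 (trivial-on-linear-parts (∈.∈-map⁺ proj₁ γ∈Γ)))
    where
    a∉ : a ∉ linear-parts
    a∉ a∈ with ∈.∈-map⁻ proj₁ a∈
    ... | _ , g∈Γ , ≡.refl = none (lose g∈Γ ≡.refl)

  translation-dichotomy : (∃[ v ] v ≢ 0# × (1# , v) ∈ Γℓ) ⊎ (∀ v → (1# , v) ∈ Γℓ → v ≡ 0#)
  translation-dichotomy with any? (λ g → (proj₁ g ≟ 1#) ×-dec ¬? (proj₂ g ≟ 0#)) Γℓ
  ... | yes found = let (_ , v) , g∈Γ , g₁≡1 , v≢0 = find found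
                    in inj₁ (v , v≢0 , subst (λ x → (x , v) ∈ Γℓ) g₁≡1 g∈Γ)
  ... | no  none  = inj₂ λ v v∈Γ → decidable-stable (v ≟ 0#) (λ v≢0 → none (lose v∈Γ (≡.refl , v≢0)))

  module WithTranslation {v} (v≢0 : v ≢ 0#) (v∈Γ : (1# , v) ∈ Γℓ) where

    translations : ∀ c → (1# , c) ∈ Γℓ
    translations c with c ≟ 0#
    ... | yes ≡.refl = has-id
    ... | no  c≢0    =
      let b , g∈Γ = linear-parts-surjective s (·-nonzero c≢0 (inv-nonzero v v≢0))
          h , h∈Γ , g∘h≡id = has-inv g∈Γ
      in subst (_∈ Γℓ) (≡.trans (conjugate-translation (s , b) h v g∘h≡id) (cong (1# ,_) s·v≡c))
               (closed g∈Γ (closed v∈Γ h∈Γ))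
      where
      s : Carrier
      s = c · inv v v≢0
      s·v≡c : s · v ≡ c
      s·v≡c = ≡.trans (*-assoc c _ v) (≡.trans (cong (c ·_) (·-inverseˡ v v≢0)) (*-identityʳ c))

    everything : ∀ g → IsAff g → g ∈ Γℓ
    everything (a , b) a≢0 =
      let b′ , g′∈Γ = linear-parts-surjective a a≢0
      in subst (_∈ Γℓ) (translate b′) (closed (translations (b ⊟ b′)) g′∈Γ)
      where
      translate : ∀ b′ → (1# , b ⊟ b′) ∘ₐ (a , b′) ≡ (a , b)
      translate b′ = cong₂ _,_ (*-identityˡ a)
        (≡.trans (cong (_⊞ (b ⊟ b′)) (*-identityˡ b′)) (solve 2 (λ b b′ → b′ :+ (b :- b′) := b) ≡.refl b b′))

  module WithoutTranslation (no-translation : ∀ v → (1# , v) ∈ Γℓ → v ≡ 0#) where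

    ≡-by-linear-part : ∀ {a b b′} → (a , b) ∈ Γℓ → (a , b′) ∈ Γℓ → b ≡ b′
    ≡-by-linear-part {a} {b} {b′} g∈Γ g′∈Γ with has-inv g∈Γ
    ... | (c , d) , h∈Γ , g∘h≡id = ⊞-cancelˡ (a · d) (≡.trans (cong proj₂ g∘h≡id) (sym g′∘h-translation))
      where
      g′∘h-translation : a · d ⊞ b′ ≡ 0#
      g′∘h-translation =
        no-translation _ (subst (λ x → (x , a · d ⊞ b′) ∈ Γℓ) (cong proj₁ g∘h≡id) (closed g′∈Γ h∈Γ))

    commutative : ∀ {g h} → g ∈ Γℓ → h ∈ Γℓ → g ∘ₐ h ≡ h ∘ₐ g
    commutative {a , b} {c , d} g∈Γ h∈Γ = cong₂ _,_ (*-comm a c)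
      (≡-by-linear-part (closed g∈Γ h∈Γ) (subst (λ x → (x , c · b ⊞ d) ∈ Γℓ) (*-comm c a) (closed h∈Γ g∈Γ)))

    -- Γ is abelian, so the unique fixed point of a non-translation in Γ is fixed by all of Γ.
    common-fixed-point : ∃[ p ] ∀ {g} → g ∈ Γℓ → act g p ≡ p
    common-fixed-point with any? (λ g → ¬? (proj₁ g ≟ 1#)) Γℓ
    ... | no all-one = 0# , fixes-0
      where
      fixes-0 : ∀ {g} → g ∈ Γℓ → act g 0# ≡ 0#
      fixes-0 {a , b} g∈Γ with a ≟ 1#
      ... | no  a≢1    = ⊥-elim (all-one (lose g∈Γ a≢1))
      ... | yes ≡.refl = ≡.trans (cong₂ _⊞_ (zeroʳ 1#) (no-translation b g∈Γ)) (+-identityˡ 0#)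
    ... | yes found =
      let γ , γ∈Γ , γ₁≢1 = find found
          p , γp≡p = fixed-point (proj₁ γ) (proj₂ γ) γ₁≢1
      in p , λ {g} g∈Γ →
           sym (fixed-point-unique γ γ₁≢1 γp≡p (commuting-preserves-fixed γ g (commutative γ∈Γ g∈Γ) γp≡p))

    p : Carrier
    p = proj₁ common-fixed-point

    stabiliser⊆Γ : ∀ g → IsAff g → act g p ≡ p → g ∈ Γℓ
    stabiliser⊆Γ (s , b) s≢0 gp≡p =
      let b′ , g′∈Γ = linear-parts-surjective s s≢0
      in subst (λ x → (s , x) ∈ Γℓ) (⊞-cancelˡ (s · p) (≡.trans (proj₂ common-fixed-point g′∈Γ) (sym gp≡p))) g′∈Γ

    size≤N : AffSubset.size Γ ℕ.≤ N
    size≤N = subst (AffSubset.size Γ ℕ.≤_) (≡.trans (length-map section units) (sym N≡|units|))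
                   (length-mono-⊆ Γ-unique (Unique.map⁺ (cong proj₁) units-unique) Γ⊆sections)
      where
      section : Carrier → Aff
      section a = a , p ⊟ a · p
      Γ⊆sections : ∀ {g} → g ∈ Γℓ → g ∈ map section units
      Γ⊆sections {a , b} g∈Γ = subst (_∈ map section units) (cong (a ,_) p-ap≡b) (∈.∈-map⁺ section (∈-units (Γ-valid g∈Γ)))
        where
        p-ap≡b : p ⊟ a · p ≡ b
        p-ap≡b = ⊞-cancelˡ (a · p) (≡.trans (solve 2 (λ x p → x :+ (p :- x) := p) ≡.refl (a · p) p)
                                            (sym (proj₂ common-fixed-point g∈Γ)))

open import Data.Nat using (ℕ; _≥_; _+_; _*_; _^_; _<_; _∸_)
open import Data.Product using (_×_; _,_; ∃)
open import Data.List.Membership.Propositional using (_∈_)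

corollary1 : (F : FiniteField) → let open FiniteField F using (order) in let open Affine F in
    (A Γ : AffSubset) → IsSubgroup Γ →
    (∀ (c : MultCharacter) → NonTrivial c →
    ∃ λ γ → γ ∈ AffSubset.elems Γ × CharNonTrivialOn c γ) →
    (z : Aff) → IsAff z → (n : ℕ) → n ≥ 1 →
    order ^ (n + 2) * (order ∸ 1) ^ 2 < AffSubset.size A ^ n * AffSubset.size Γ ^ 2 →
    MeetsLeftCoset n A z Γ × MeetsRightCoset n A z Γ
corollary1 F A Γ Γ-subgroup separated z z-aff n n≥1 bound = cosets translation-dichotomy
  where
  open FiniteField F using (order; 0#; 1#)
  open Affine F
  open AffineGroup F using (meetsCosets-if-full; meetsCosets-if-stabiliser)
  open Averaging F using (module Operator)
  open SubgroupStructure F Γ Γ-subgroup separated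

  cosets : (∃[ v ] v ≢ 0# × (1# , v) ∈ AffSubset.elems Γ) ⊎ (∀ v → (1# , v) ∈ AffSubset.elems Γ → v ≡ 0#) →
           MeetsLeftCoset n A z Γ × MeetsRightCoset n A z Γ
  cosets (inj₁ (v , v≢0 , v∈Γ)) =
    let a , a∈A = <-length^⇒nonempty (AffSubset.elems A) n≥1 bound
    in meetsCosets-if-full A Γ z-aff (WithTranslation.everything v≢0 v∈Γ) (Vec.replicate n a) (All-replicate n a∈A)
  cosets (inj₂ no-translation) = meetsCosets-if-stabiliser A Γ z-aff p stabiliser⊆Γ (Operator.transitive A n q^[n+2]<|A|ⁿ)
    where
    open WithoutTranslation no-translation
    q^[n+2]<|A|ⁿ : order ^ (n + 2) < AffSubset.size A ^ n
    q^[n+2]<|A|ⁿ = x*c<y*d⇒x<y _ _ (ℕP.^-monoˡ-≤ 2 size≤N) bound
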